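{- Let $b\in\mathbb{R}$ and let $(p_n(b,x))_{n\ge0}$ be the monic polynomials defined by $p_{ -1}(b,x)=0$, $p_0(b,x)=1$ and $$p_n(b,x)=(x-s_{n-1})p_{n-1}(b,x)-t_{n-2}\,p_{n-2}(b,x)\quad(n\ge1),$$ where $s_0=b+2$, $s_n=2$ for $n\ge1$, $t_0=2-b$, $t_n=1$ for $n\ge1$ (the term with $t_{ -1}$ is absent for $n=1$). Then: (i) for every $n\ge1$, $$p_n(b,x)=\sum_{j=0}^{n}(-1)^{n-j}\binom{n+j}{2j}\frac{2n}{n+j}x^j+b\sum_{j=0}^{n}(-1)^{n-j}\binom{n+j}{2j+1}\frac{2n-1}{n+j}x^j;$$ (ii) if $\Lambda$ is the linear functional on polynomials defined by $\Lambda(p_n(b,x))=[n=0]$, then the moments are $$M(b,n):=\Lambda(x^n)=\sum_{j=0}^{n}\binom{n+j}{j}b^{n-j};$$ (iii) for every positive integer $k$, $\det\left(M(b,i+j)\right)_{i,j=0}^{k-1}=(2-b)^{k-1}$.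
   Context: $[n=0]$ equals $1$ if $n=0$ and $0$ otherwise. Since the $p_n(b,x)$ form a basis of the polynomials, $\Lambda$ is well defined by the stated values.
   Formalization: The parameter b is rational rather than real, so the functional Λ acts on polynomials with rational coefficients. -}

module Defs where

open import Data.Nat as ℕ using (ℕ; zero; suc)
open import Data.Nat.Combinatorics using (_C_)
open import Data.Integer as ℤ using (ℤ; +_)
open import Data.Rational using (ℚ; 0ℚ; 1ℚ; _+_; _*_; -_; _-_; _/_)
open import Data.List using (List; []; _∷_)
open import Relation.Binary.PropositionalEquality using (_≡_)
open import Data.Fin using (Fin; zero; suc; toℕ; punchIn)

-- Polynomials over ℚ as coefficient lists (constant term first).
Poly : Set
Poly = List ℚ

coeff : Poly → ℕ → ℚ
coeff []       _       = 0ℚ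
coeff (c ∷ _)  zero    = c
coeff (_ ∷ cs) (suc j) = coeff cs j

_⊕_ : Poly → Poly → Poly
[]       ⊕ q        = q
(c ∷ p)  ⊕ []       = c ∷ p
(c ∷ p)  ⊕ (d ∷ q)  = (c + d) ∷ (p ⊕ q)

_·_ : ℚ → Poly → Poly
a · []      = []
a · (c ∷ p) = (a * c) ∷ (a · p)

shiftX : Poly → Poly
shiftX p = 0ℚ ∷ p

X^ : ℕ → Poly
X^ zero    = 1ℚ ∷ []
X^ (suc n) = shiftX (X^ n)

ℕ→ℚ : ℕ → ℚ
ℕ→ℚ n = (+ n) / 1

_^ℚ_ : ℚ → ℕ → ℚ
a ^ℚ zero  = 1ℚ
a ^ℚ suc n = a * (a ^ℚ n)

s : ℚ → ℕ → ℚ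
s b zero    = b + ℕ→ℚ 2
s b (suc _) = ℕ→ℚ 2

t : ℚ → ℕ → ℚ
t b zero    = ℕ→ℚ 2 - b
t b (suc _) = 1ℚ

-- p b n = p_n(b,x), monic of degree n:
-- p_0 = 1, p_1 = (x - s_0) p_0 (using p_{-1} = 0),
-- p_{n+2} = (x - s_{n+1}) p_{n+1} - t_n p_n
p : ℚ → ℕ → Poly
p b zero          = 1ℚ ∷ []
p b (suc zero)    = shiftX (p b zero) ⊕ ((- s b zero) · p b zero)
p b (suc (suc n)) =
  (shiftX (p b (suc n)) ⊕ ((- s b (suc n)) · p b (suc n))) ⊕ ((- t b n) · p b n)

sgn : ℕ → ℚ
sgn k = (- 1ℚ) ^ℚ k

closedCoeff : ℚ → ℕ → ℕ → ℚ
closedCoeff b m j =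
  sgn (n ℕ.∸ j) * ((+ (((n ℕ.+ j) C (2 ℕ.* j)) ℕ.* (2 ℕ.* n))) / suc (m ℕ.+ j))
  + b * (sgn (n ℕ.∸ j) * ((+ (((n ℕ.+ j) C (suc (2 ℕ.* j))) ℕ.* (2 ℕ.* n ℕ.∸ 1))) / suc (m ℕ.+ j)))
  where n = suc m

iverson0 : ℕ → ℚ
iverson0 zero    = 1ℚ
iverson0 (suc _) = 0ℚ

record IsLinear (L : Poly → ℚ) : Set where
  field
    additive : ∀ f g → L (f ⊕ g) ≡ L f + L g
    homogeneous : ∀ a f → L (a · f) ≡ a * L f

sumTo : ℕ → (ℕ → ℚ) → ℚ
sumTo zero    f = f zero
sumTo (suc n) f = sumTo n f + f (suc n)

M : ℚ → ℕ → ℚ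
M b n = sumTo n (λ j → ℕ→ℚ ((n ℕ.+ j) C j) * (b ^ℚ (n ℕ.∸ j)))

sumFin : ∀ n → (Fin n → ℚ) → ℚ
sumFin zero    f = 0ℚ
sumFin (suc n) f = f zero + sumFin n (λ i → f (suc i))

det : ∀ n → (Fin n → Fin n → ℚ) → ℚ
det zero    A = 1ℚ
det (suc n) A =
  sumFin (suc n) (λ j → sgn (toℕ j) * (A zero j * det n (λ i k → A (suc i) (punchIn j k))))

module Submission where

-- (i) For n ≥ 1 the coefficient sequences of p_(n+1) satisfy the b-free recurrence
-- c(n+2) = (x - 2) c(n+1) - c(n). The identity C(N, k) (2N - k) = (C(N, k) + C(N-1, k)) N turns the
-- coefficients in (i) into (-1)^(n-j) (C(n+j, 2j+e) + C(n-1+j, 2j+e)), e = 0, 1: consecutive differences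
-- of the sequences (-1)^(n+j) C(n+j, 2j+e), which satisfy the same recurrence by Pascal's rule. So (i)
-- reduces to p_1 and p_2.
-- (ii) The numbers Λ(x^n p_k) satisfy the recursion dual to x p_k = p_(k+1) + s_k p_k + t_(k-1) p_(k-1),
-- starting from Λ(p_k) = [k = 0]; its solution is Σ_j C(n+j, n+k) b^(n-j), times 2 - b when k > 0.
-- (iii) Multiplying the Hankel matrix by the unitriangular coefficient matrix of p_0, …, p_k gives the
-- triangular matrix (Λ(x^j p_i)) with diagonal 1, 2 - b, …, 2 - b. The determinant (Laplace expansion
-- along the first row) is unchanged by this product since it is multilinear and alternating in the rows.

open import Defs
open import Data.Nat using (ℕ; suc)
open import Data.Fin using (toℕ)
open import Data.Rational using (ℚ; _-_)
open import Data.Product using (_×_)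
open import Relation.Binary.PropositionalEquality using (_≡_)

open import Level using (0ℓ)
open import Algebra.Bundles using (CommutativeMonoid)
open import Function.Base using (_∘_; const)
open import Data.Empty using (⊥-elim)
open import Data.Product using (_,_; proj₁)
open import Data.Sum using ([_,_]′)
open import Data.List using ([]; _∷_)
open import Data.Nat as ℕ using (zero; _≤_; _<_; z≤n; s≤s)
import Data.Nat.Properties as ℕₚ
open import Data.Nat.Combinatorics using (_C_; nCk+nC[k+1]≡[n+1]C[k+1]; k>n⇒nCk≡0; nCn≡1; nC1≡n; nCk≡nC[n∸k])
open import Data.Fin as Fin using (Fin; zero; suc; punchIn; punchOut; fromℕ<)
import Data.Fin.Properties as Finₚ
open import Data.Vec.Functional using (updateAt)
open import Data.Vec.Functional.Properties using (updateAt-updates; updateAt-minimal; updateAt-id-local)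
import Data.Integer as ℤ
import Data.Integer.Properties as ℤₚ
open import Data.Rational as ℚ using (0ℚ; 1ℚ; ½; _+_; _*_; -_; _/_)
open import Data.Rational.Properties
open import Algebra.Properties.CommutativeSemigroup (CommutativeMonoid.commutativeSemigroup +-0-commutativeMonoid)
  using () renaming (interchange to +-interchange; x∙yz≈y∙xz to +-left-comm)
import Data.Rational.Unnormalised as ℚᵘ
import Data.Rational.Unnormalised.Properties as ℚᵘₚ
open import Relation.Nullary using (yes; no)
open import Relation.Nullary.Decidable.Core using (dec⇒maybe)
open import Relation.Binary.PropositionalEquality
open import Tactic.RingSolver using (solve-∀)
open import Tactic.RingSolver.Core.AlmostCommutativeRing using (AlmostCommutativeRing; fromCommutativeRing)
open import Data.Integer.Tactic.RingSolver using () renaming (solve-∀ to ℤ-solve-∀)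
open import Data.Nat.Tactic.RingSolver using () renaming (solve-∀ to ℕ-solve-∀)

ℚ-ring : AlmostCommutativeRing 0ℓ 0ℓ
ℚ-ring = fromCommutativeRing +-*-commutativeRing (λ x → dec⇒maybe (0ℚ ≟ x))

x≡-x⇒x≡0 : ∀ {x} → x ≡ - x → x ≡ 0ℚ
x≡-x⇒x≡0 {x} x≡-x = begin
  x               ≡⟨ half-double x ⟩
  ½ * (x + x)     ≡⟨ cong (λ y → ½ * (x + y)) x≡-x ⟩
  ½ * (x + - x)   ≡⟨ half-cancel x ⟩
  0ℚ              ∎
  where
  open ≡-Reasoning
  half-double : ∀ x → x ≡ ½ * (x + x)
  half-double = solve-∀ ℚ-ring
  half-cancel : ∀ x → ½ * (x + - x) ≡ 0ℚ
  half-cancel = solve-∀ ℚ-ring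

x*[y*0]≡0 : ∀ x y → x * (y * 0ℚ) ≡ 0ℚ
x*[y*0]≡0 = solve-∀ ℚ-ring

1*x+0≡x : ∀ x → 1ℚ * x + 0ℚ ≡ x
1*x+0≡x = solve-∀ ℚ-ring

ℕ→ℚ-+ : ∀ m n → ℕ→ℚ (m ℕ.+ n) ≡ ℕ→ℚ m + ℕ→ℚ n
ℕ→ℚ-+ m n = toℚᵘ-injective (begin
  ℚ.toℚᵘ (ℕ→ℚ (m ℕ.+ n))                 ≈⟨ toℚᵘ-fromℚᵘ (ℕ→ℚᵘ (m ℕ.+ n)) ⟩
  ℕ→ℚᵘ (m ℕ.+ n)                         ≈⟨ ℚᵘ.*≡* (trans (cong (ℤ._* ℤ.+ 1) (ℤₚ.pos-+ m n)) (sum-over-1 (ℤ.+ m) (ℤ.+ n))) ⟩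
  ℕ→ℚᵘ m ℚᵘ.+ ℕ→ℚᵘ n                     ≈⟨ ℚᵘₚ.+-cong (ℚᵘₚ.≃-sym (toℚᵘ-fromℚᵘ (ℕ→ℚᵘ m)))
                                                        (ℚᵘₚ.≃-sym (toℚᵘ-fromℚᵘ (ℕ→ℚᵘ n))) ⟩
  ℚ.toℚᵘ (ℕ→ℚ m) ℚᵘ.+ ℚ.toℚᵘ (ℕ→ℚ n)   ≈⟨ ℚᵘₚ.≃-sym (toℚᵘ-homo-+ (ℕ→ℚ m) (ℕ→ℚ n)) ⟩
  ℚ.toℚᵘ (ℕ→ℚ m + ℕ→ℚ n)                 ∎)
  where
  open ℚᵘₚ.≃-Reasoning
  ℕ→ℚᵘ : ℕ → ℚᵘ.ℚᵘ
  ℕ→ℚᵘ k = ℚᵘ.mkℚᵘ (ℤ.+ k) 0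
  sum-over-1 : ∀ a b → (a ℤ.+ b) ℤ.* ℤ.+ 1 ≡ (a ℤ.* ℤ.+ 1 ℤ.+ b ℤ.* ℤ.+ 1) ℤ.* ℤ.+ 1
  sum-over-1 = ℤ-solve-∀

m*[1+d]/[1+d]≡m : ∀ m d → (ℤ.+ (m ℕ.* suc d)) / suc d ≡ ℕ→ℚ m
m*[1+d]/[1+d]≡m m d = fromℚᵘ-cong {ℚᵘ.mkℚᵘ (ℤ.+ (m ℕ.* suc d)) d} {ℚᵘ.mkℚᵘ (ℤ.+ m) 0}
  (ℚᵘ.*≡* (trans (ℤₚ.*-identityʳ (ℤ.+ (m ℕ.* suc d))) (ℤₚ.pos-* m (suc d))))

sgn-suc-suc : ∀ k → sgn (suc (suc k)) ≡ sgn k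
sgn-suc-suc k = [-1*][-1*x]≡x (sgn k)
  where
  [-1*][-1*x]≡x : ∀ x → - 1ℚ * (- 1ℚ * x) ≡ x
  [-1*][-1*x]≡x = solve-∀ ℚ-ring

sgn-+-double : ∀ j a → sgn (j ℕ.+ (j ℕ.+ a)) ≡ sgn a
sgn-+-double zero    a = refl
sgn-+-double (suc j) a = begin
  sgn (suc (j ℕ.+ suc (j ℕ.+ a)))   ≡⟨ cong (sgn ∘ suc) (ℕₚ.+-suc j (j ℕ.+ a)) ⟩
  sgn (suc (suc (j ℕ.+ (j ℕ.+ a)))) ≡⟨ sgn-suc-suc (j ℕ.+ (j ℕ.+ a)) ⟩
  sgn (j ℕ.+ (j ℕ.+ a))             ≡⟨ sgn-+-double j a ⟩
  sgn a                             ∎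
  where open ≡-Reasoning

sgn-∸≡sgn-+ : ∀ {n j} → j ≤ n → sgn (n ℕ.∸ j) ≡ sgn (n ℕ.+ j)
sgn-∸≡sgn-+ {n} {j} j≤n = sym (begin
  sgn (n ℕ.+ j)                       ≡⟨ cong (λ k → sgn (k ℕ.+ j)) (sym (ℕₚ.m∸n+n≡m j≤n)) ⟩
  sgn (n ℕ.∸ j ℕ.+ j ℕ.+ j)           ≡⟨ cong sgn (reorder (n ℕ.∸ j) j) ⟩
  sgn (j ℕ.+ (j ℕ.+ (n ℕ.∸ j)))       ≡⟨ sgn-+-double j (n ℕ.∸ j) ⟩
  sgn (n ℕ.∸ j)                       ∎)
  where
  open ≡-Reasoning
  reorder : ∀ d j → d ℕ.+ j ℕ.+ j ≡ j ℕ.+ (j ℕ.+ d)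
  reorder = ℕ-solve-∀

binom : ℕ → ℕ → ℚ
binom n k = ℕ→ℚ (n C k)

binom-pascal : ∀ n k → binom (suc n) (suc k) ≡ binom n k + binom n (suc k)
binom-pascal n k = trans (cong ℕ→ℚ (sym (nCk+nC[k+1]≡[n+1]C[k+1] n k))) (ℕ→ℚ-+ (n C k) (n C suc k))

binom-vanish : ∀ {n k} → n < k → binom n k ≡ 0ℚ
binom-vanish n<k = cong ℕ→ℚ (k>n⇒nCk≡0 n<k)

binom-diag : ∀ n → binom n n ≡ 1ℚ
binom-diag n = cong ℕ→ℚ (nCn≡1 n)

sumFin-cong : ∀ n {f g : Fin n → ℚ} → (∀ i → f i ≡ g i) → sumFin n f ≡ sumFin n g
sumFin-cong zero    f≗g = refl
sumFin-cong (suc n) f≗g = cong₂ _+_ (f≗g zero) (sumFin-cong n (f≗g ∘ suc))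

sumFin-+ : ∀ n (f g : Fin n → ℚ) → sumFin n (λ i → f i + g i) ≡ sumFin n f + sumFin n g
sumFin-+ zero    f g = refl
sumFin-+ (suc n) f g = trans (cong ((f zero + g zero) +_) (sumFin-+ n (f ∘ suc) (g ∘ suc)))
                             (+-interchange (f zero) (g zero) (sumFin n (f ∘ suc)) (sumFin n (g ∘ suc)))

sumFin-* : ∀ n c (f : Fin n → ℚ) → sumFin n (λ i → c * f i) ≡ c * sumFin n f
sumFin-* zero    c f = sym (*-zeroʳ c)
sumFin-* (suc n) c f = trans (cong (c * f zero +_) (sumFin-* n c (f ∘ suc)))
                             (sym (*-distribˡ-+ c (f zero) (sumFin n (f ∘ suc))))

sumFin-neg : ∀ n (f : Fin n → ℚ) → sumFin n (λ i → - f i) ≡ - sumFin n f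
sumFin-neg zero    f = refl
sumFin-neg (suc n) f = trans (cong (- f zero +_) (sumFin-neg n (f ∘ suc)))
                             (sym (neg-distrib-+ (f zero) (sumFin n (f ∘ suc))))

sumFin-zero : ∀ n {f : Fin n → ℚ} → (∀ i → f i ≡ 0ℚ) → sumFin n f ≡ 0ℚ
sumFin-zero n f≗0 = trans (sumFin-cong n f≗0) (zeros n)
  where
  zeros : ∀ n → sumFin n (λ _ → 0ℚ) ≡ 0ℚ
  zeros zero    = refl
  zeros (suc n) = cong (0ℚ +_) (zeros n)

sumFin-swap : ∀ m n (f : Fin m → Fin n → ℚ) →
  sumFin m (λ i → sumFin n (f i)) ≡ sumFin n (λ j → sumFin m (λ i → f i j))
sumFin-swap zero    n f = sym (sumFin-zero n (λ _ → refl))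
sumFin-swap (suc m) n f = trans (cong (sumFin n (f zero) +_) (sumFin-swap m n (f ∘ suc)))
                                (sym (sumFin-+ n (f zero) (λ j → sumFin m (λ i → f (suc i) j))))

sumFin-punchIn : ∀ m (j : Fin (suc m)) (h : Fin (suc m) → ℚ) →
  sumFin (suc m) h ≡ h j + sumFin m (h ∘ punchIn j)
sumFin-punchIn m       zero    h = refl
sumFin-punchIn (suc m) (suc j) h = trans (cong (h zero +_) (sumFin-punchIn m j (h ∘ suc)))
                                         (+-left-comm (h zero) (h (suc j)) (sumFin m (h ∘ suc ∘ punchIn j)))

sumFin-antisymmetric : ∀ n (G : Fin n → Fin n → ℚ) → (∀ i j → G i j ≡ - G j i) →
  sumFin n (λ i → sumFin n (G i)) ≡ 0ℚ
sumFin-antisymmetric n G anti = x≡-x⇒x≡0 (begin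
  sumFin n (λ i → sumFin n (G i))             ≡⟨ sumFin-swap n n G ⟩
  sumFin n (λ j → sumFin n (λ i → G i j))     ≡⟨ sumFin-cong n (λ j → sumFin-cong n (λ i → anti i j)) ⟩
  sumFin n (λ j → sumFin n (λ i → - G j i))   ≡⟨ sumFin-cong n (λ j → sumFin-neg n (G j)) ⟩
  sumFin n (λ j → - sumFin n (G j))           ≡⟨ sumFin-neg n (λ j → sumFin n (G j)) ⟩
  - sumFin n (λ j → sumFin n (G j))           ∎)
  where open ≡-Reasoning

sumTo-cong : ∀ n {f g : ℕ → ℚ} → (∀ j → j ≤ n → f j ≡ g j) → sumTo n f ≡ sumTo n g
sumTo-cong zero    f≗g = f≗g 0 z≤n
sumTo-cong (suc n) f≗g = cong₂ _+_ (sumTo-cong n (λ j j≤n → f≗g j (ℕₚ.m≤n⇒m≤1+n j≤n))) (f≗g (suc n) ℕₚ.≤-refl)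

sumTo-+ : ∀ n (f g : ℕ → ℚ) → sumTo n (λ j → f j + g j) ≡ sumTo n f + sumTo n g
sumTo-+ zero    f g = refl
sumTo-+ (suc n) f g = trans (cong (_+ (f (suc n) + g (suc n))) (sumTo-+ n f g))
                            (+-interchange (sumTo n f) (sumTo n g) (f (suc n)) (g (suc n)))

sumTo-* : ∀ n c (f : ℕ → ℚ) → sumTo n (λ j → c * f j) ≡ c * sumTo n f
sumTo-* zero    c f = refl
sumTo-* (suc n) c f = trans (cong (_+ c * f (suc n)) (sumTo-* n c f)) (sym (*-distribˡ-+ c (sumTo n f) (f (suc n))))

sumTo-head : ∀ n (f : ℕ → ℚ) → sumTo (suc n) f ≡ f 0 + sumTo n (f ∘ suc)
sumTo-head zero    f = refl
sumTo-head (suc n) f = trans (cong (_+ f (suc (suc n))) (sumTo-head n f)) (+-assoc (f 0) _ _)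

horner : ℚ → ℕ → (ℕ → ℚ) → ℚ
horner b n f = sumTo n (λ j → f j * b ^ℚ (n ℕ.∸ j))

module _ (b : ℚ) where

  horner-cong : ∀ n {f g : ℕ → ℚ} → (∀ j → f j ≡ g j) → horner b n f ≡ horner b n g
  horner-cong n f≗g = sumTo-cong n (λ j _ → cong (_* b ^ℚ (n ℕ.∸ j)) (f≗g j))

  horner-+ : ∀ n (f g : ℕ → ℚ) → horner b n (λ j → f j + g j) ≡ horner b n f + horner b n g
  horner-+ n f g = trans (sumTo-cong n (λ j _ → *-distribʳ-+ (b ^ℚ (n ℕ.∸ j)) (f j) (g j)))
                         (sumTo-+ n (λ j → f j * b ^ℚ (n ℕ.∸ j)) (λ j → g j * b ^ℚ (n ℕ.∸ j)))

  horner-* : ∀ n c (f : ℕ → ℚ) → horner b n (λ j → c * f j) ≡ c * horner b n f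
  horner-* n c f = trans (sumTo-cong n (λ j _ → *-assoc c (f j) (b ^ℚ (n ℕ.∸ j))))
                         (sumTo-* n c (λ j → f j * b ^ℚ (n ℕ.∸ j)))

  horner-head : ∀ n (f : ℕ → ℚ) → horner b (suc n) f ≡ f 0 * b ^ℚ suc n + horner b n (f ∘ suc)
  horner-head n f = sumTo-head n (λ j → f j * b ^ℚ (suc n ℕ.∸ j))

  horner-suc : ∀ n (f : ℕ → ℚ) → horner b (suc n) f ≡ b * horner b n f + f (suc n)
  horner-suc n f = cong₂ _+_
    (trans (sumTo-cong n λ j j≤n → trans (cong (λ e → f j * b ^ℚ e) (ℕₚ.+-∸-assoc 1 j≤n))
                                         (x*[b*y]≡b*[x*y] (f j) b (b ^ℚ (n ℕ.∸ j))))
           (sumTo-* n b (λ j → f j * b ^ℚ (n ℕ.∸ j))))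
    (trans (cong (λ e → f (suc n) * b ^ℚ e) (ℕₚ.n∸n≡0 n)) (*-identityʳ (f (suc n))))
    where
    x*[b*y]≡b*[x*y] : ∀ x b y → x * (b * y) ≡ b * (x * y)
    x*[b*y]≡b*[x*y] = solve-∀ ℚ-ring

  horner-- : ∀ n (f g : ℕ → ℚ) → horner b n (λ j → f j - g j) ≡ horner b n f - horner b n g
  horner-- n f g = begin
    horner b n (λ j → f j - g j)                 ≡⟨ horner-cong n (λ j → x-y≡x+[-1]*y (f j) (g j)) ⟩
    horner b n (λ j → f j + - 1ℚ * g j)          ≡⟨ horner-+ n f (λ j → - 1ℚ * g j) ⟩
    horner b n f + horner b n (λ j → - 1ℚ * g j) ≡⟨ cong (horner b n f +_) (horner-* n (- 1ℚ) g) ⟩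
    horner b n f + - 1ℚ * horner b n g           ≡⟨ sym (x-y≡x+[-1]*y (horner b n f) (horner b n g)) ⟩
    horner b n f - horner b n g                  ∎
    where
    open ≡-Reasoning
    x-y≡x+[-1]*y : ∀ x y → x - y ≡ x + - 1ℚ * y
    x-y≡x+[-1]*y = solve-∀ ℚ-ring

-- Determinants

Mat : ℕ → Set
Mat n = Fin n → Fin n → ℚ

minor : ∀ {n} → Mat (suc n) → Fin (suc n) → Mat n
minor A j i k = A (suc i) (punchIn j k)

det-cong : ∀ n {A B : Mat n} → (∀ i j → A i j ≡ B i j) → det n A ≡ det n B
det-cong zero    A≗B = refl
det-cong (suc n) A≗B = sumFin-cong (suc n) λ j →
  cong₂ (λ a d → sgn (toℕ j) * (a * d)) (A≗B zero j) (det-cong n (λ i k → A≗B (suc i) (punchIn j k)))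

det-lincomb-laplace : ∀ n (A B L : Mat (suc n)) α β →
  (∀ j → L zero j * det n (minor L j) ≡ α * (A zero j * det n (minor A j)) + β * (B zero j * det n (minor B j))) →
  det (suc n) L ≡ α * det (suc n) A + β * det (suc n) B
det-lincomb-laplace n A B L α β terms = begin
  sumFin (suc n) (λ j → sgn (toℕ j) * (L zero j * det n (minor L j)))
    ≡⟨ sumFin-cong (suc n) (λ j → trans (cong (sgn (toℕ j) *_) (terms j)) (distrib (sgn (toℕ j)) α β (a j) (b j))) ⟩
  sumFin (suc n) (λ j → α * (sgn (toℕ j) * a j) + β * (sgn (toℕ j) * b j))
    ≡⟨ sumFin-+ (suc n) (λ j → α * (sgn (toℕ j) * a j)) (λ j → β * (sgn (toℕ j) * b j)) ⟩
  sumFin (suc n) (λ j → α * (sgn (toℕ j) * a j)) + sumFin (suc n) (λ j → β * (sgn (toℕ j) * b j))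
    ≡⟨ cong₂ _+_ (sumFin-* (suc n) α (λ j → sgn (toℕ j) * a j)) (sumFin-* (suc n) β (λ j → sgn (toℕ j) * b j)) ⟩
  α * det (suc n) A + β * det (suc n) B ∎
  where
  open ≡-Reasoning
  a b : Fin (suc n) → ℚ
  a j = A zero j * det n (minor A j)
  b j = B zero j * det n (minor B j)
  distrib : ∀ σ α β x y → σ * (α * x + β * y) ≡ α * (σ * x) + β * (σ * y)
  distrib = solve-∀ ℚ-ring

det-row-linear : ∀ n (A B L : Mat n) (i : Fin n) α β →
  (∀ r → r ≢ i → ∀ k → B r k ≡ A r k) →
  (∀ r → r ≢ i → ∀ k → L r k ≡ A r k) →
  (∀ k → L i k ≡ α * A i k + β * B i k) →
  det n L ≡ α * det n A + β * det n B
det-row-linear (suc n) A B L zero α β B≈A L≈A Lᵢ = det-lincomb-laplace n A B L α β λ j → begin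
  L zero j * det n (minor L j)                          ≡⟨ cong₂ _*_ (Lᵢ j) (det-cong n (λ r k → L≈A (suc r) (λ ()) (punchIn j k))) ⟩
  (α * A zero j + β * B zero j) * det n (minor A j)     ≡⟨ distrib α β (A zero j) (B zero j) (det n (minor A j)) ⟩
  α * (A zero j * det n (minor A j)) + β * (B zero j * det n (minor A j))
    ≡⟨ cong (λ d → α * (A zero j * det n (minor A j)) + β * (B zero j * d))
            (det-cong n (λ r k → sym (B≈A (suc r) (λ ()) (punchIn j k)))) ⟩
  α * (A zero j * det n (minor A j)) + β * (B zero j * det n (minor B j)) ∎
  where
  open ≡-Reasoning
  distrib : ∀ α β x y d → (α * x + β * y) * d ≡ α * (x * d) + β * (y * d)
  distrib = solve-∀ ℚ-ring
det-row-linear (suc n) A B L (suc i) α β B≈A L≈A Lᵢ = det-lincomb-laplace n A B L α β λ j → begin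
  L zero j * det n (minor L j)
    ≡⟨ cong₂ _*_ (L≈A zero (λ ()) j)
         (det-row-linear n (minor A j) (minor B j) (minor L j) i α β
           (λ r r≢i k → B≈A (suc r) (r≢i ∘ Finₚ.suc-injective) (punchIn j k))
           (λ r r≢i k → L≈A (suc r) (r≢i ∘ Finₚ.suc-injective) (punchIn j k))
           (λ k → Lᵢ (punchIn j k))) ⟩
  A zero j * (α * det n (minor A j) + β * det n (minor B j))
    ≡⟨ distrib α β (A zero j) (det n (minor A j)) (det n (minor B j)) ⟩
  α * (A zero j * det n (minor A j)) + β * (A zero j * det n (minor B j))
    ≡⟨ cong (λ x → α * (A zero j * det n (minor A j)) + β * (x * det n (minor B j))) (sym (B≈A zero (λ ()) j)) ⟩
  α * (A zero j * det n (minor A j)) + β * (B zero j * det n (minor B j)) ∎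
  where
  open ≡-Reasoning
  distrib : ∀ α β x d e → x * (α * d + β * e) ≡ α * (x * d) + β * (x * e)
  distrib = solve-∀ ℚ-ring

punchIn-punchOut-comm : ∀ {n} {j l : Fin (suc (suc n))} (j≢l : j ≢ l) (l≢j : l ≢ j) (c : Fin n) →
  punchIn j (punchIn (punchOut j≢l) c) ≡ punchIn l (punchIn (punchOut l≢j) c)
punchIn-punchOut-comm {_}     {zero}  {zero}  j≢l _   c       = ⊥-elim (j≢l refl)
punchIn-punchOut-comm {_}     {zero}  {suc l} _   _   c       = refl
punchIn-punchOut-comm {_}     {suc j} {zero}  _   _   c       = refl
punchIn-punchOut-comm {suc n} {suc j} {suc l} _   _   zero    = refl
punchIn-punchOut-comm {suc n} {suc j} {suc l} j≢l l≢j (suc c) =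
  cong suc (punchIn-punchOut-comm (j≢l ∘ cong suc) (l≢j ∘ cong suc) c)

sgn-punchOut-anti : ∀ {n} {j l : Fin (suc (suc n))} (j≢l : j ≢ l) (l≢j : l ≢ j) →
  sgn (toℕ j) * sgn (toℕ (punchOut j≢l)) ≡ - (sgn (toℕ l) * sgn (toℕ (punchOut l≢j)))
sgn-punchOut-anti {_}     {zero}      {zero}      j≢l _   = ⊥-elim (j≢l refl)
sgn-punchOut-anti {_}     {zero}      {suc l}     _   _   = sign-zero-suc (sgn (toℕ l))
  where
  sign-zero-suc : ∀ x → 1ℚ * x ≡ - ((- 1ℚ * x) * 1ℚ)
  sign-zero-suc = solve-∀ ℚ-ring
sgn-punchOut-anti {_}     {suc j}     {zero}      _   _   = sign-suc-zero (sgn (toℕ j))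
  where
  sign-suc-zero : ∀ x → (- 1ℚ * x) * 1ℚ ≡ - (1ℚ * x)
  sign-suc-zero = solve-∀ ℚ-ring
sgn-punchOut-anti {zero}  {suc zero}  {suc zero}  j≢l _   = ⊥-elim (j≢l refl)
sgn-punchOut-anti {suc n} {suc j}     {suc l}     j≢l l≢j = begin
  (- 1ℚ * sgn (toℕ j)) * (- 1ℚ * sgn (toℕ (punchOut j≢l′)))     ≡⟨ both-neg (sgn (toℕ j)) (sgn (toℕ (punchOut j≢l′))) ⟩
  sgn (toℕ j) * sgn (toℕ (punchOut j≢l′))                      ≡⟨ sgn-punchOut-anti j≢l′ l≢j′ ⟩
  - (sgn (toℕ l) * sgn (toℕ (punchOut l≢j′)))                  ≡⟨ cong -_ (sym (both-neg (sgn (toℕ l)) (sgn (toℕ (punchOut l≢j′))))) ⟩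
  - ((- 1ℚ * sgn (toℕ l)) * (- 1ℚ * sgn (toℕ (punchOut l≢j′)))) ∎
  where
  open ≡-Reasoning
  j≢l′ = j≢l ∘ cong suc
  l≢j′ = l≢j ∘ cong suc
  both-neg : ∀ x y → (- 1ℚ * x) * (- 1ℚ * y) ≡ x * y
  both-neg = solve-∀ ℚ-ring

-- term j l is the contribution of columns j and l of rows 0 and 1 to the Laplace expansion along both rows
module TwoRowExpansion {n} (A : Mat (suc (suc n))) where

  rest : Fin (suc (suc n)) → Fin (suc n) → ℚ
  rest j k = det n (minor (minor A j) k)

  term : Fin (suc (suc n)) → Fin (suc (suc n)) → ℚ
  term j l with j Fin.≟ l
  ... | yes _   = 0ℚ
  ... | no j≢l  = sgn (toℕ j) * sgn (toℕ (punchOut j≢l)) * (A zero j * A (suc zero) l * rest j (punchOut j≢l))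

  term-diag : ∀ j → term j j ≡ 0ℚ
  term-diag j with j Fin.≟ j
  ... | yes _   = refl
  ... | no j≢j  = ⊥-elim (j≢j refl)

  term-punchIn : ∀ j k → term j (punchIn j k) ≡ sgn (toℕ j) * (A zero j * (sgn (toℕ k) * (A (suc zero) (punchIn j k) * rest j k)))
  term-punchIn j k with j Fin.≟ punchIn j k
  ... | yes j≡ = ⊥-elim (Finₚ.punchInᵢ≢i j k (sym j≡))
  ... | no j≢  = begin
    sgn (toℕ j) * sgn (toℕ (punchOut j≢)) * (A zero j * A (suc zero) (punchIn j k) * rest j (punchOut j≢))
      ≡⟨ cong (λ c → sgn (toℕ j) * sgn (toℕ c) * (A zero j * A (suc zero) (punchIn j k) * rest j c)) punchOut≡k ⟩
    sgn (toℕ j) * sgn (toℕ k) * (A zero j * A (suc zero) (punchIn j k) * rest j k)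
      ≡⟨ regroup (sgn (toℕ j)) (sgn (toℕ k)) (A zero j) (A (suc zero) (punchIn j k)) (rest j k) ⟩
    sgn (toℕ j) * (A zero j * (sgn (toℕ k) * (A (suc zero) (punchIn j k) * rest j k))) ∎
    where
    open ≡-Reasoning
    punchOut≡k : punchOut j≢ ≡ k
    punchOut≡k = trans (Finₚ.punchOut-cong j refl) (Finₚ.punchOut-punchIn j)
    regroup : ∀ σ τ a b d → σ * τ * (a * b * d) ≡ σ * (a * (τ * (b * d)))
    regroup = solve-∀ ℚ-ring

  det≡sum-terms : det (suc (suc n)) A ≡ sumFin (suc (suc n)) (λ j → sumFin (suc (suc n)) (term j))
  det≡sum-terms = sumFin-cong (suc (suc n)) λ j → begin
    sgn (toℕ j) * (A zero j * det (suc n) (minor A j))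
      ≡⟨ cong (sgn (toℕ j) *_) (sym (sumFin-* (suc n) (A zero j) (laplace j))) ⟩
    sgn (toℕ j) * sumFin (suc n) (λ k → A zero j * laplace j k)
      ≡⟨ sym (sumFin-* (suc n) (sgn (toℕ j)) (λ k → A zero j * laplace j k)) ⟩
    sumFin (suc n) (λ k → sgn (toℕ j) * (A zero j * laplace j k))
      ≡⟨ sym (sumFin-cong (suc n) (term-punchIn j)) ⟩
    sumFin (suc n) (term j ∘ punchIn j)
      ≡⟨ sym (+-identityˡ _) ⟩
    0ℚ + sumFin (suc n) (term j ∘ punchIn j)
      ≡⟨ cong (_+ sumFin (suc n) (term j ∘ punchIn j)) (sym (term-diag j)) ⟩
    term j j + sumFin (suc n) (term j ∘ punchIn j)
      ≡⟨ sym (sumFin-punchIn (suc n) j (term j)) ⟩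
    sumFin (suc (suc n)) (term j) ∎
    where
    open ≡-Reasoning
    laplace : Fin (suc (suc n)) → Fin (suc n) → ℚ
    laplace j k = sgn (toℕ k) * (A (suc zero) (punchIn j k) * rest j k)

  term-antisym : (∀ k → A zero k ≡ A (suc zero) k) → ∀ j l → term j l ≡ - term l j
  term-antisym row₀≡row₁ j l with j Fin.≟ l | l Fin.≟ j
  ... | yes _   | yes _   = refl
  ... | yes j≡l | no l≢j  = ⊥-elim (l≢j (sym j≡l))
  ... | no j≢l  | yes l≡j = ⊥-elim (j≢l (sym l≡j))
  ... | no j≢l  | no l≢j  = begin
    sgn (toℕ j) * sgn (toℕ (punchOut j≢l)) * (A zero j * A (suc zero) l * rest j (punchOut j≢l))
      ≡⟨ cong₂ _*_ (sgn-punchOut-anti j≢l l≢j) (cong₂ _*_ entries rests) ⟩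
    - (sgn (toℕ l) * sgn (toℕ (punchOut l≢j))) * (A zero l * A (suc zero) j * rest l (punchOut l≢j))
      ≡⟨ sym (neg-distribˡ-* (sgn (toℕ l) * sgn (toℕ (punchOut l≢j))) (A zero l * A (suc zero) j * rest l (punchOut l≢j))) ⟩
    - (sgn (toℕ l) * sgn (toℕ (punchOut l≢j)) * (A zero l * A (suc zero) j * rest l (punchOut l≢j))) ∎
    where
    open ≡-Reasoning
    entries : A zero j * A (suc zero) l ≡ A zero l * A (suc zero) j
    entries = trans (cong₂ _*_ (row₀≡row₁ j) (sym (row₀≡row₁ l))) (*-comm (A (suc zero) j) (A zero l))
    rests : rest j (punchOut j≢l) ≡ rest l (punchOut l≢j)
    rests = det-cong n (λ i c → cong (A (suc (suc i))) (punchIn-punchOut-comm j≢l l≢j c))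

det-row0≡row1⇒0 : ∀ n (A : Mat (suc (suc n))) → (∀ k → A zero k ≡ A (suc zero) k) → det (suc (suc n)) A ≡ 0ℚ
det-row0≡row1⇒0 n A row₀≡row₁ =
  trans det≡sum-terms (sumFin-antisymmetric (suc (suc n)) term (term-antisym row₀≡row₁))
  where open TwoRowExpansion A

module ReplaceTwoRows {n} (A : Mat (suc (suc (suc n)))) (i : Fin (suc n)) where

  N : ℕ
  N = suc (suc (suc n))

  lower : Fin (suc n) → Fin N → ℚ
  lower r = A (suc (suc r))

  with-rows : (x y : Fin N → ℚ) → Mat N
  with-rows x y zero          = A zero
  with-rows x y (suc zero)    = x
  with-rows x y (suc (suc r)) = updateAt lower i (const y) r

  D : (x y : Fin N → ℚ) → ℚ
  D x y = det N (with-rows x y)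

  u v : Fin N → ℚ
  u = A (suc zero)
  v = A (suc (suc i))

  with-rows-id : ∀ r k → with-rows u v r k ≡ A r k
  with-rows-id zero          k = refl
  with-rows-id (suc zero)    k = refl
  with-rows-id (suc (suc r)) k = cong-app (updateAt-id-local i lower refl r) k

  row-y : ∀ x y → with-rows x y (suc (suc i)) ≡ y
  row-y x y = updateAt-updates i lower

  rows≢x : ∀ x x′ y r → r ≢ suc zero → ∀ k → with-rows x′ y r k ≡ with-rows x y r k
  rows≢x x x′ y zero          _   k = refl
  rows≢x x x′ y (suc zero)    r≢1 k = ⊥-elim (r≢1 refl)
  rows≢x x x′ y (suc (suc r)) _   k = refl

  rows≢y : ∀ x y y′ r → r ≢ suc (suc i) → ∀ k → with-rows x y′ r k ≡ with-rows x y r k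
  rows≢y x y y′ zero          _   k = refl
  rows≢y x y y′ (suc zero)    _   k = refl
  rows≢y x y y′ (suc (suc r)) r≢i k = cong-app (trans (updateAt-minimal r i lower r≢i′)
                                                      (sym (updateAt-minimal r i lower r≢i′))) k
    where r≢i′ = r≢i ∘ cong (λ r → suc (suc r))

  1*a+1*b≡a+b : ∀ a b → 1ℚ * a + 1ℚ * b ≡ a + b
  1*a+1*b≡a+b = solve-∀ ℚ-ring

  D-linearˡ : ∀ x x′ y → D (λ k → x k + x′ k) y ≡ D x y + D x′ y
  D-linearˡ x x′ y = trans
    (det-row-linear N (with-rows x y) (with-rows x′ y) (with-rows (λ k → x k + x′ k) y) (suc zero) 1ℚ 1ℚ
      (rows≢x x x′ y) (rows≢x x (λ k → x k + x′ k) y) (λ k → sym (1*a+1*b≡a+b (x k) (x′ k))))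
    (1*a+1*b≡a+b (D x y) (D x′ y))

  D-linearʳ : ∀ x y y′ → D x (λ k → y k + y′ k) ≡ D x y + D x y′
  D-linearʳ x y y′ = trans
    (det-row-linear N (with-rows x y) (with-rows x y′) (with-rows x (λ k → y k + y′ k)) (suc (suc i)) 1ℚ 1ℚ
      (rows≢y x y y′) (rows≢y x y (λ k → y k + y′ k))
      (λ k → trans (cong-app (row-y x (λ k → y k + y′ k)) k)
                   (trans (sym (1*a+1*b≡a+b (y k) (y′ k)))
                          (sym (cong₂ (λ a b → 1ℚ * a + 1ℚ * b) (cong-app (row-y x y) k) (cong-app (row-y x y′) k))))))
    (1*a+1*b≡a+b (D x y) (D x y′))

  D-diag : (∀ (B : Mat (suc (suc n))) → (∀ k → B zero k ≡ B (suc i) k) → det (suc (suc n)) B ≡ 0ℚ) →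
           ∀ x → D x x ≡ 0ℚ
  D-diag alternating x = sumFin-zero N λ j → trans
    (cong (λ d → sgn (toℕ j) * (A zero j * d))
          (alternating (minor (with-rows x x) j) (λ k → sym (cong-app (row-y x x) (punchIn j k)))))
    (x*[y*0]≡0 (sgn (toℕ j)) (A zero j))

det-row0≡row⇒0 : ∀ n (A : Mat (suc n)) (i : Fin n) → (∀ k → A zero k ≡ A (suc i) k) → det (suc n) A ≡ 0ℚ
det-row0≡row⇒0 (suc n)       A zero    row₀≡rowᵢ = det-row0≡row1⇒0 n A row₀≡rowᵢ
-- D is bilinear and vanishes on the diagonal and at (v, u), where rows 0 and 1 agree; polarise.
det-row0≡row⇒0 (suc (suc n)) A (suc i) row₀≡rowᵢ = begin
  det N A                                          ≡⟨ sym (det-cong N with-rows-id) ⟩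
  D u v                                            ≡⟨ pad (D u v) ⟩
  (0ℚ + D u v) + (0ℚ + 0ℚ)                         ≡⟨ cong₂ (λ a b → (a + D u v) + (b + 0ℚ)) (sym (D-diag′ u)) (sym D-v-u) ⟩
  (D u u + D u v) + (D v u + 0ℚ)                   ≡⟨ cong (λ a → (D u u + D u v) + (D v u + a)) (sym (D-diag′ v)) ⟩
  (D u u + D u v) + (D v u + D v v)                ≡⟨ sym (cong₂ _+_ (D-linearʳ u u v) (D-linearʳ v u v)) ⟩
  D u (λ k → u k + v k) + D v (λ k → u k + v k)    ≡⟨ sym (D-linearˡ u v (λ k → u k + v k)) ⟩
  D (λ k → u k + v k) (λ k → u k + v k)            ≡⟨ D-diag′ (λ k → u k + v k) ⟩
  0ℚ                                               ∎
  where
  open ≡-Reasoning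
  open ReplaceTwoRows A i
  D-diag′ : ∀ x → D x x ≡ 0ℚ
  D-diag′ = D-diag (λ B → det-row0≡row⇒0 (suc n) B i)
  D-v-u : D v u ≡ 0ℚ
  D-v-u = det-row0≡row1⇒0 (suc n) (with-rows v u) row₀≡rowᵢ
  pad : ∀ a → a ≡ (0ℚ + a) + (0ℚ + 0ℚ)
  pad = solve-∀ ℚ-ring

addRow0 : ∀ {n} → Mat (suc n) → (Fin n → ℚ) → Mat (suc n)
addRow0 A c zero    k = A zero k
addRow0 A c (suc i) k = A (suc i) k + c i * A zero k

det-addRow0-zeroAt : ∀ n (A : Mat (suc n)) (c : Fin n → ℚ) (i : Fin n) →
  det (suc n) (addRow0 A c) ≡ det (suc n) (addRow0 A (updateAt c i (const 0ℚ)))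
det-addRow0-zeroAt n A c i = begin
  det (suc n) (addRow0 A c)                    ≡⟨ det-row-linear (suc n) A′ R (addRow0 A c) (suc i) 1ℚ (c i) R≈A′ C≈A′ rowᵢ ⟩
  1ℚ * det (suc n) A′ + c i * det (suc n) R    ≡⟨ cong (λ d → 1ℚ * det (suc n) A′ + c i * d) (det-row0≡row⇒0 n R i R₀≡Rᵢ) ⟩
  1ℚ * det (suc n) A′ + c i * 0ℚ               ≡⟨ 1*x+y*0≡x (det (suc n) A′) (c i) ⟩
  det (suc n) A′                               ∎
  where
  open ≡-Reasoning
  1*x+y*0≡x : ∀ x y → 1ℚ * x + y * 0ℚ ≡ x
  1*x+y*0≡x = solve-∀ ℚ-ring
  x+y*z≡1*[x+0*z]+y*z : ∀ x y z → x + y * z ≡ 1ℚ * (x + 0ℚ * z) + y * z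
  x+y*z≡1*[x+0*z]+y*z = solve-∀ ℚ-ring
  A′ R : Mat (suc n)
  A′ = addRow0 A (updateAt c i (const 0ℚ))
  R  = updateAt A′ (suc i) (const (A zero))
  R≈A′ : ∀ r → r ≢ suc i → ∀ k → R r k ≡ A′ r k
  R≈A′ r r≢i k = cong-app (updateAt-minimal r (suc i) A′ r≢i) k
  C≈A′ : ∀ r → r ≢ suc i → ∀ k → addRow0 A c r k ≡ A′ r k
  C≈A′ zero    _   k = refl
  C≈A′ (suc r) r≢i k = cong (λ x → A (suc r) k + x * A zero k) (sym (updateAt-minimal r i c (r≢i ∘ cong suc)))
  rowᵢ : ∀ k → addRow0 A c (suc i) k ≡ 1ℚ * A′ (suc i) k + c i * R (suc i) k
  rowᵢ k = trans (x+y*z≡1*[x+0*z]+y*z (A (suc i) k) (c i) (A zero k))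
                 (sym (cong₂ (λ a r → 1ℚ * (A (suc i) k + a * A zero k) + c i * r)
                             (updateAt-updates i c) (cong-app (updateAt-updates (suc i) A′) k)))
  R₀≡Rᵢ : ∀ k → R zero k ≡ R (suc i) k
  R₀≡Rᵢ k = sym (cong-app (updateAt-updates (suc i) A′) k)

det-addRow0 : ∀ n (A : Mat (suc n)) (c : Fin n → ℚ) → det (suc n) (addRow0 A c) ≡ det (suc n) A
det-addRow0 n A c = supported-below n c (λ i n≤i → ⊥-elim (ℕₚ.<⇒≱ (Finₚ.toℕ<n i) n≤i))
  where
  supported-below : ∀ m (c : Fin n → ℚ) → (∀ i → m ≤ toℕ i → c i ≡ 0ℚ) → det (suc n) (addRow0 A c) ≡ det (suc n) A
  supported-below zero c c≡0 = det-cong (suc n) unchanged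
    where
    x+0*y≡x : ∀ x y → x + 0ℚ * y ≡ x
    x+0*y≡x = solve-∀ ℚ-ring
    unchanged : ∀ r k → addRow0 A c r k ≡ A r k
    unchanged zero    k = refl
    unchanged (suc i) k = trans (cong (λ x → A (suc i) k + x * A zero k) (c≡0 i z≤n)) (x+0*y≡x (A (suc i) k) (A zero k))
  supported-below (suc m) c c≡0 with m ℕ.<? n
  ... | no  m≮n = supported-below m c (λ i m≤i → ⊥-elim (m≮n (ℕₚ.≤-<-trans m≤i (Finₚ.toℕ<n i))))
  ... | yes m<n = trans (det-addRow0-zeroAt n A c i) (supported-below m (updateAt c i (const 0ℚ)) c′≡0)
    where
    i = fromℕ< m<n
    c′≡0 : ∀ r → m ≤ toℕ r → updateAt c i (const 0ℚ) r ≡ 0ℚ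
    c′≡0 r m≤r with r Fin.≟ i
    ... | yes refl = updateAt-updates i c
    ... | no  r≢i  = trans (updateAt-minimal r i c r≢i)
                           (c≡0 r (ℕₚ.≤∧≢⇒< m≤r (λ m≡r → r≢i (Finₚ.toℕ-injective (trans (sym m≡r) (sym (Finₚ.toℕ-fromℕ< m<n)))))))

infixl 7 _*ᴹ_
_*ᴹ_ : ∀ {n} → Mat n → Mat n → Mat n
_*ᴹ_ {n} P A i j = sumFin n (λ r → P i r * A r j)

det-lowerUnitriangular-*ᴹ : ∀ n (P A : Mat n) → (∀ i → P i i ≡ 1ℚ) → (∀ i r → i Fin.< r → P i r ≡ 0ℚ) →
  det n (P *ᴹ A) ≡ det n A
det-lowerUnitriangular-*ᴹ zero    P A diag upper = refl
det-lowerUnitriangular-*ᴹ (suc n) P A diag upper = begin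
  det (suc n) (P *ᴹ A)      ≡⟨ det-cong (suc n) P*A≡ ⟩
  det (suc n) (addRow0 B c) ≡⟨ det-addRow0 n B c ⟩
  det (suc n) B             ≡⟨ sumFin-cong (suc n) (λ j → cong (λ d → sgn (toℕ j) * (A zero j * d))
                                 (det-lowerUnitriangular-*ᴹ n P′ (minor A j) (diag ∘ suc) (λ i r i<r → upper (suc i) (suc r) (s≤s i<r)))) ⟩
  det (suc n) A             ∎
  where
  open ≡-Reasoning
  P′ : Mat n
  P′ i r = P (suc i) (suc r)
  B : Mat (suc n)
  B zero    j = A zero j
  B (suc i) j = sumFin n (λ r → P′ i r * A (suc r) j)
  c : Fin n → ℚ
  c i = P (suc i) zero
  P*A≡ : ∀ i k → (P *ᴹ A) i k ≡ addRow0 B c i k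
  P*A≡ zero    k = trans (cong₂ (λ d s → d * A zero k + s) (diag zero)
                                (sumFin-zero n (λ r → trans (cong (_* A (suc r) k) (upper zero (suc r) (s≤s z≤n))) (*-zeroˡ (A (suc r) k)))))
                         (1*x+0≡x (A zero k))
  P*A≡ (suc i) k = +-comm (P (suc i) zero * A zero k) (B (suc i) k)

UpperTriangular : ∀ {n} → Mat n → Set
UpperTriangular A = ∀ i j → j Fin.< i → A i j ≡ 0ℚ

laplace-term≡0 : ∀ n (A : Mat (suc n)) → (∀ i → A i zero ≡ 0ℚ) → ∀ j → sgn (toℕ j) * (A zero j * det n (minor A j)) ≡ 0ℚ
laplace-term≡0 n       A col≡0 zero    = trans (cong (λ a → 1ℚ * (a * det n (minor A zero))) (col≡0 zero)) (1*[0*x]≡0 (det n (minor A zero)))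
  where
  1*[0*x]≡0 : ∀ x → 1ℚ * (0ℚ * x) ≡ 0ℚ
  1*[0*x]≡0 = solve-∀ ℚ-ring
laplace-term≡0 (suc n) A col≡0 (suc j) =
  trans (cong (λ d → sgn (toℕ (suc j)) * (A zero (suc j) * d)) (sumFin-zero (suc n) (laplace-term≡0 n (minor A (suc j)) (col≡0 ∘ suc))))
        (x*[y*0]≡0 (sgn (toℕ (suc j))) (A zero (suc j)))

det-column0≡0 : ∀ n (A : Mat (suc n)) → (∀ i → A i zero ≡ 0ℚ) → det (suc n) A ≡ 0ℚ
det-column0≡0 n A col≡0 = sumFin-zero (suc n) (laplace-term≡0 n A col≡0)

det-upperTriangular : ∀ n (A : Mat (suc n)) → UpperTriangular A → det (suc n) A ≡ A zero zero * det n (λ i j → A (suc i) (suc j))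
det-upperTriangular n A upper =
  trans (cong (1ℚ * (A zero zero * det n (minor A zero)) +_) (sumFin-zero n (later-terms n A upper)))
        (1*x+0≡x (A zero zero * det n (minor A zero)))
  where
  later-terms : ∀ n (A : Mat (suc n)) → UpperTriangular A → ∀ j → sgn (toℕ (suc j)) * (A zero (suc j) * det n (minor A (suc j))) ≡ 0ℚ
  later-terms (suc n) A upper j =
    trans (cong (λ d → sgn (toℕ (suc j)) * (A zero (suc j) * d)) (det-column0≡0 n (minor A (suc j)) (λ i → upper (suc i) zero (s≤s z≤n))))
          (x*[y*0]≡0 (sgn (toℕ (suc j))) (A zero (suc j)))

det-upperTriangular-constDiag : ∀ n (A : Mat n) c → UpperTriangular A → (∀ i → A i i ≡ c) → det n A ≡ c ^ℚ n
det-upperTriangular-constDiag zero    A c upper diag = refl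
det-upperTriangular-constDiag (suc n) A c upper diag =
  trans (det-upperTriangular n A upper)
        (cong₂ _*_ (diag zero) (det-upperTriangular-constDiag n (λ i j → A (suc i) (suc j)) c
                                  (λ i j j<i → upper (suc i) (suc j) (s≤s j<i)) (diag ∘ suc)))

coeff-⊕ : ∀ f g r → coeff (f ⊕ g) r ≡ coeff f r + coeff g r
coeff-⊕ []      g       r       = sym (+-identityˡ (coeff g r))
coeff-⊕ (c ∷ f) []      r       = sym (+-identityʳ (coeff (c ∷ f) r))
coeff-⊕ (c ∷ f) (d ∷ g) zero    = refl
coeff-⊕ (c ∷ f) (d ∷ g) (suc r) = coeff-⊕ f g r

coeff-· : ∀ a f r → coeff (a · f) r ≡ a * coeff f r
coeff-· a []      r       = sym (*-zeroʳ a)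
coeff-· a (c ∷ f) zero    = refl
coeff-· a (c ∷ f) (suc r) = coeff-· a f r

coeff-isLinear : ∀ r → IsLinear (λ f → coeff f r)
coeff-isLinear r = record { additive = λ f g → coeff-⊕ f g r ; homogeneous = λ a f → coeff-· a f r }

module _ (b : ℚ) {F : Poly → ℚ} (F-linear : IsLinear F) where
  open IsLinear F-linear

  p-recurrence₁ : F (p b 1) ≡ F (shiftX (p b 0)) - s b 0 * F (p b 0)
  p-recurrence₁ = begin
    F (shiftX (p b 0) ⊕ ((- s b 0) · p b 0))       ≡⟨ additive (shiftX (p b 0)) ((- s b 0) · p b 0) ⟩
    F (shiftX (p b 0)) + F ((- s b 0) · p b 0)   ≡⟨ cong (F (shiftX (p b 0)) +_) (homogeneous (- s b 0) (p b 0)) ⟩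
    F (shiftX (p b 0)) + (- s b 0) * F (p b 0)   ≡⟨ x+[-a]*y≡x-a*y (F (shiftX (p b 0))) (s b 0) (F (p b 0)) ⟩
    F (shiftX (p b 0)) - s b 0 * F (p b 0)       ∎
    where
    open ≡-Reasoning
    x+[-a]*y≡x-a*y : ∀ x a y → x + (- a) * y ≡ x - a * y
    x+[-a]*y≡x-a*y = solve-∀ ℚ-ring

  p-recurrence : ∀ k → F (p b (suc (suc k))) ≡ F (shiftX (p b (suc k))) - s b (suc k) * F (p b (suc k)) - t b k * F (p b k)
  p-recurrence k = begin
    F ((shiftX p₁ ⊕ ((- s b (suc k)) · p₁)) ⊕ ((- t b k) · p₀))
      ≡⟨ additive (shiftX p₁ ⊕ ((- s b (suc k)) · p₁)) ((- t b k) · p₀) ⟩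
    F (shiftX p₁ ⊕ ((- s b (suc k)) · p₁)) + F ((- t b k) · p₀)
      ≡⟨ cong₂ _+_ (additive (shiftX p₁) ((- s b (suc k)) · p₁)) (homogeneous (- t b k) p₀) ⟩
    F (shiftX p₁) + F ((- s b (suc k)) · p₁) + (- t b k) * F p₀
      ≡⟨ cong (λ y → F (shiftX p₁) + y + (- t b k) * F p₀) (homogeneous (- s b (suc k)) p₁) ⟩
    F (shiftX p₁) + (- s b (suc k)) * F p₁ + (- t b k) * F p₀
      ≡⟨ x+[-a]*y+[-b]*z≡x-a*y-b*z (F (shiftX p₁)) (s b (suc k)) (F p₁) (t b k) (F p₀) ⟩
    F (shiftX p₁) - s b (suc k) * F p₁ - t b k * F p₀ ∎
    where
    open ≡-Reasoning
    p₁ = p b (suc k)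
    p₀ = p b k
    x+[-a]*y+[-b]*z≡x-a*y-b*z : ∀ x a y b z → x + (- a) * y + (- b) * z ≡ x - a * y - b * z
    x+[-a]*y+[-b]*z≡x-a*y-b*z = solve-∀ ℚ-ring

xshift : (ℕ → ℚ) → ℕ → ℚ
xshift f zero    = 0ℚ
xshift f (suc j) = f j

coeff-shiftX : ∀ f j → coeff (shiftX f) j ≡ xshift (coeff f) j
coeff-shiftX f zero    = refl
coeff-shiftX f (suc j) = refl

coeff-p-vanish : ∀ b n r → n < r → coeff (p b n) r ≡ 0ℚ
coeff-p-vanish b zero          (suc r)       _         = refl
coeff-p-vanish b (suc zero)    (suc zero)    (s≤s ())
coeff-p-vanish b (suc zero)    (suc (suc r)) _         = trans (p-recurrence₁ b (coeff-isLinear (suc (suc r)))) (0-a*0≡0 (s b 0))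
  where
  0-a*0≡0 : ∀ a → 0ℚ - a * 0ℚ ≡ 0ℚ
  0-a*0≡0 = solve-∀ ℚ-ring
coeff-p-vanish b (suc (suc n)) (suc r)       (s≤s n<r) = begin
  coeff (p b (suc (suc n))) (suc r)
    ≡⟨ p-recurrence b (coeff-isLinear (suc r)) n ⟩
  coeff (p b (suc n)) r - s b (suc n) * coeff (p b (suc n)) (suc r) - t b n * coeff (p b n) (suc r)
    ≡⟨ cong₂ (λ x y → x - s b (suc n) * y - t b n * coeff (p b n) (suc r))
             (coeff-p-vanish b (suc n) r n<r) (coeff-p-vanish b (suc n) (suc r) (ℕₚ.m<n⇒m<1+n n<r)) ⟩
  0ℚ - s b (suc n) * 0ℚ - t b n * coeff (p b n) (suc r)
    ≡⟨ cong (λ z → 0ℚ - s b (suc n) * 0ℚ - t b n * z) (coeff-p-vanish b n (suc r) (ℕₚ.m<n⇒m<1+n (ℕₚ.<-trans (ℕₚ.n<1+n n) n<r))) ⟩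
  0ℚ - s b (suc n) * 0ℚ - t b n * 0ℚ
    ≡⟨ 0-a*0-b*0≡0 (s b (suc n)) (t b n) ⟩
  0ℚ ∎
  where
  open ≡-Reasoning
  0-a*0-b*0≡0 : ∀ a b → 0ℚ - a * 0ℚ - b * 0ℚ ≡ 0ℚ
  0-a*0-b*0≡0 = solve-∀ ℚ-ring

coeff-p-monic : ∀ b n → coeff (p b n) n ≡ 1ℚ
coeff-p-monic b zero          = refl
coeff-p-monic b (suc zero)    = trans (p-recurrence₁ b (coeff-isLinear 1)) (1-a*0≡1 (s b 0))
  where
  1-a*0≡1 : ∀ a → 1ℚ - a * 0ℚ ≡ 1ℚ
  1-a*0≡1 = solve-∀ ℚ-ring
coeff-p-monic b (suc (suc n)) = begin
  coeff (p b (suc (suc n))) (suc (suc n))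
    ≡⟨ p-recurrence b (coeff-isLinear (suc (suc n))) n ⟩
  coeff (p b (suc n)) (suc n) - s b (suc n) * coeff (p b (suc n)) (suc (suc n)) - t b n * coeff (p b n) (suc (suc n))
    ≡⟨ cong₂ (λ x y → x - s b (suc n) * y - t b n * coeff (p b n) (suc (suc n)))
             (coeff-p-monic b (suc n)) (coeff-p-vanish b (suc n) (suc (suc n)) ℕₚ.≤-refl) ⟩
  1ℚ - s b (suc n) * 0ℚ - t b n * coeff (p b n) (suc (suc n))
    ≡⟨ cong (λ z → 1ℚ - s b (suc n) * 0ℚ - t b n * z) (coeff-p-vanish b n (suc (suc n)) (ℕₚ.m<n⇒m<1+n ℕₚ.≤-refl)) ⟩
  1ℚ - s b (suc n) * 0ℚ - t b n * 0ℚ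
    ≡⟨ 1-a*0-b*0≡1 (s b (suc n)) (t b n) ⟩
  1ℚ ∎
  where
  open ≡-Reasoning
  1-a*0-b*0≡1 : ∀ a b → 1ℚ - a * 0ℚ - b * 0ℚ ≡ 1ℚ
  1-a*0-b*0≡1 = solve-∀ ℚ-ring

-- The closed form (i)

[1+k]*[1+n]C[1+k]≡[1+n]*nCk : ∀ n k → suc k ℕ.* (suc n C suc k) ≡ suc n ℕ.* (n C k)
[1+k]*[1+n]C[1+k]≡[1+n]*nCk zero    zero    = refl
[1+k]*[1+n]C[1+k]≡[1+n]*nCk zero    (suc k) = ℕₚ.*-zeroʳ (suc (suc k))
[1+k]*[1+n]C[1+k]≡[1+n]*nCk (suc n) zero    = trans (ℕₚ.+-identityʳ (suc (suc n) C 1)) (trans (nC1≡n (suc (suc n))) (sym (ℕₚ.*-identityʳ (suc (suc n)))))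
[1+k]*[1+n]C[1+k]≡[1+n]*nCk (suc n) (suc k) = begin
  suc (suc k) ℕ.* (suc (suc n) C suc (suc k))
    ≡⟨ cong (suc (suc k) ℕ.*_) (sym (nCk+nC[k+1]≡[n+1]C[k+1] (suc n) (suc k))) ⟩
  suc (suc k) ℕ.* (suc n C suc k ℕ.+ suc n C suc (suc k))
    ≡⟨ split k (suc n C suc k) (suc n C suc (suc k)) ⟩
  suc k ℕ.* (suc n C suc k) ℕ.+ suc (suc k) ℕ.* (suc n C suc (suc k)) ℕ.+ suc n C suc k
    ≡⟨ cong₂ (λ x y → x ℕ.+ y ℕ.+ suc n C suc k) ([1+k]*[1+n]C[1+k]≡[1+n]*nCk n k) ([1+k]*[1+n]C[1+k]≡[1+n]*nCk n (suc k)) ⟩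
  suc n ℕ.* (n C k) ℕ.+ suc n ℕ.* (n C suc k) ℕ.+ suc n C suc k
    ≡⟨ cong (ℕ._+ suc n C suc k) (sym (ℕₚ.*-distribˡ-+ (suc n) (n C k) (n C suc k))) ⟩
  suc n ℕ.* (n C k ℕ.+ n C suc k) ℕ.+ suc n C suc k
    ≡⟨ cong (λ x → suc n ℕ.* x ℕ.+ suc n C suc k) (nCk+nC[k+1]≡[n+1]C[k+1] n k) ⟩
  suc n ℕ.* (suc n C suc k) ℕ.+ suc n C suc k
    ≡⟨ ℕₚ.+-comm (suc n ℕ.* (suc n C suc k)) (suc n C suc k) ⟩
  suc (suc n) ℕ.* (suc n C suc k) ∎
  where
  open ≡-Reasoning
  split : ∀ k x y → suc (suc k) ℕ.* (x ℕ.+ y) ≡ suc k ℕ.* x ℕ.+ suc (suc k) ℕ.* y ℕ.+ x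
  split = ℕ-solve-∀

nCk*[1+n]+k*[1+n]Ck≡[1+n]*[1+n]Ck : ∀ n k → (n C k) ℕ.* suc n ℕ.+ k ℕ.* (suc n C k) ≡ suc n ℕ.* (suc n C k)
nCk*[1+n]+k*[1+n]Ck≡[1+n]*[1+n]Ck n zero    = trans (ℕₚ.+-identityʳ (1 ℕ.* suc n)) (ℕₚ.*-comm 1 (suc n))
nCk*[1+n]+k*[1+n]Ck≡[1+n]*[1+n]Ck n (suc k) = begin
  (n C suc k) ℕ.* suc n ℕ.+ suc k ℕ.* (suc n C suc k)  ≡⟨ cong ((n C suc k) ℕ.* suc n ℕ.+_) ([1+k]*[1+n]C[1+k]≡[1+n]*nCk n k) ⟩
  (n C suc k) ℕ.* suc n ℕ.+ suc n ℕ.* (n C k)          ≡⟨ x*m+m*y≡m*[y+x] (n C suc k) (suc n) (n C k) ⟩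
  suc n ℕ.* (n C k ℕ.+ n C suc k)                      ≡⟨ cong (suc n ℕ.*_) (nCk+nC[k+1]≡[n+1]C[k+1] n k) ⟩
  suc n ℕ.* (suc n C suc k)                            ∎
  where
  open ≡-Reasoning
  x*m+m*y≡m*[y+x] : ∀ x m y → x ℕ.* m ℕ.+ m ℕ.* y ≡ m ℕ.* (y ℕ.+ x)
  x*m+m*y≡m*[y+x] = ℕ-solve-∀

-- C(N, k) (2N - k) = (C(N, k) + C(N - 1, k)) N for N = suc n, stated without subtraction
[1+n]Ck*a≡[[1+n]Ck+nCk]*[1+n] : ∀ n k a → a ℕ.+ k ≡ 2 ℕ.* suc n → (suc n C k) ℕ.* a ≡ (suc n C k ℕ.+ n C k) ℕ.* suc n
[1+n]Ck*a≡[[1+n]Ck+nCk]*[1+n] n k a a+k≡2[1+n] = ℕₚ.+-cancelʳ-≡ (k ℕ.* C₁) (C₁ ℕ.* a) ((C₁ ℕ.+ C₀) ℕ.* suc n) (begin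
  C₁ ℕ.* a ℕ.+ k ℕ.* C₁                      ≡⟨ x*a+k*x≡x*[a+k] C₁ a k ⟩
  C₁ ℕ.* (a ℕ.+ k)                           ≡⟨ cong (C₁ ℕ.*_) a+k≡2[1+n] ⟩
  C₁ ℕ.* (2 ℕ.* suc n)                       ≡⟨ x*[2*m]≡m*x+m*x C₁ (suc n) ⟩
  suc n ℕ.* C₁ ℕ.+ suc n ℕ.* C₁              ≡⟨ cong (suc n ℕ.* C₁ ℕ.+_) (sym (nCk*[1+n]+k*[1+n]Ck≡[1+n]*[1+n]Ck n k)) ⟩
  suc n ℕ.* C₁ ℕ.+ (C₀ ℕ.* suc n ℕ.+ k ℕ.* C₁) ≡⟨ regroup (suc n) C₁ C₀ (k ℕ.* C₁) ⟩
  (C₁ ℕ.+ C₀) ℕ.* suc n ℕ.+ k ℕ.* C₁          ∎)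
  where
  open ≡-Reasoning
  C₀ = n C k
  C₁ = suc n C k
  x*a+k*x≡x*[a+k] : ∀ x a k → x ℕ.* a ℕ.+ k ℕ.* x ≡ x ℕ.* (a ℕ.+ k)
  x*a+k*x≡x*[a+k] = ℕ-solve-∀
  x*[2*m]≡m*x+m*x : ∀ x m → x ℕ.* (2 ℕ.* m) ≡ m ℕ.* x ℕ.+ m ℕ.* x
  x*[2*m]≡m*x+m*x = ℕ-solve-∀
  regroup : ∀ m x y z → m ℕ.* x ℕ.+ (y ℕ.* m ℕ.+ z) ≡ (x ℕ.+ y) ℕ.* m ℕ.+ z
  regroup = ℕ-solve-∀

binom-ratio : ∀ n k a → a ℕ.+ k ≡ 2 ℕ.* suc n → (ℤ.+ ((suc n C k) ℕ.* a)) / suc n ≡ binom (suc n) k + binom n k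
binom-ratio n k a a+k≡2[1+n] = begin
  (ℤ.+ ((suc n C k) ℕ.* a)) / suc n                  ≡⟨ cong (λ x → (ℤ.+ x) / suc n) ([1+n]Ck*a≡[[1+n]Ck+nCk]*[1+n] n k a a+k≡2[1+n]) ⟩
  (ℤ.+ ((suc n C k ℕ.+ n C k) ℕ.* suc n)) / suc n    ≡⟨ m*[1+d]/[1+d]≡m (suc n C k ℕ.+ n C k) n ⟩
  ℕ→ℚ (suc n C k ℕ.+ n C k)                          ≡⟨ ℕ→ℚ-+ (suc n C k) (n C k) ⟩
  binom (suc n) k + binom n k                        ∎
  where open ≡-Reasoning

binom-recurrence : ∀ n k → binom (suc (suc n)) (suc (suc k)) + binom n (suc (suc k)) ≡ binom n k + ℕ→ℚ 2 * binom (suc n) (suc (suc k))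
binom-recurrence n k = begin
  binom (suc (suc n)) (suc (suc k)) + binom n (suc (suc k))
    ≡⟨ cong (_+ z) (trans (binom-pascal (suc n) (suc k)) (cong₂ _+_ (binom-pascal n k) (binom-pascal n (suc k)))) ⟩
  ((x + y) + (y + z)) + z              ≡⟨ regroup x y z ⟩
  x + ℕ→ℚ 2 * (y + z)                  ≡⟨ cong (λ w → x + ℕ→ℚ 2 * w) (sym (binom-pascal n (suc k))) ⟩
  x + ℕ→ℚ 2 * binom (suc n) (suc (suc k)) ∎
  where
  open ≡-Reasoning
  x = binom n k
  y = binom n (suc k)
  z = binom n (suc (suc k))
  regroup : ∀ x y z → ((x + y) + (y + z)) + z ≡ x + ℕ→ℚ 2 * (y + z)
  regroup = solve-∀ ℚ-ring

-- c n is the coefficient sequence of the n-th polynomial; xshift is multiplication by x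
Recurrent : (ℕ → ℕ → ℚ) → Set
Recurrent c = ∀ n j → c (suc (suc n)) j ≡ xshift (c (suc n)) j - ℕ→ℚ 2 * c (suc n) j - c n j

xshift-cong : ∀ {f g} → (∀ j → f j ≡ g j) → ∀ j → xshift f j ≡ xshift g j
xshift-cong f≗g zero    = refl
xshift-cong f≗g (suc j) = f≗g j

Recurrent-unique : ∀ {c d} → Recurrent c → Recurrent d →
  (∀ j → c 0 j ≡ d 0 j) → (∀ j → c 1 j ≡ d 1 j) → ∀ n j → c n j ≡ d n j
Recurrent-unique {c} {d} rec-c rec-d c₀≗d₀ c₁≗d₁ n = proj₁ (consecutive n)
  where
  consecutive : ∀ n → (∀ j → c n j ≡ d n j) × (∀ j → c (suc n) j ≡ d (suc n) j)
  consecutive zero = c₀≗d₀ , c₁≗d₁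
  consecutive (suc n) with consecutive n
  ... | cₙ≗dₙ , cₙ₊₁≗dₙ₊₁ = cₙ₊₁≗dₙ₊₁ , λ j → trans (rec-c n j)
    (trans (cong₂ _-_ (cong₂ (λ x y → x - ℕ→ℚ 2 * y) (xshift-cong cₙ₊₁≗dₙ₊₁ j) (cₙ₊₁≗dₙ₊₁ j)) (cₙ≗dₙ j))
           (sym (rec-d n j)))

Recurrent-lincomb : ∀ {c d e} α β → Recurrent c → Recurrent d →
  (∀ n j → e n j ≡ α * c n j + β * d n j) → Recurrent e
Recurrent-lincomb {c} {d} {e} α β rec-c rec-d e≗ n j = begin
  e (suc (suc n)) j
    ≡⟨ e≗ (suc (suc n)) j ⟩
  α * c (suc (suc n)) j + β * d (suc (suc n)) j
    ≡⟨ cong₂ (λ x y → α * x + β * y) (rec-c n j) (rec-d n j) ⟩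
  α * (xshift (c (suc n)) j - ℕ→ℚ 2 * c (suc n) j - c n j) + β * (xshift (d (suc n)) j - ℕ→ℚ 2 * d (suc n) j - d n j)
    ≡⟨ regroup α β (xshift (c (suc n)) j) (xshift (d (suc n)) j) (c (suc n) j) (d (suc n) j) (c n j) (d n j) ⟩
  (α * xshift (c (suc n)) j + β * xshift (d (suc n)) j) - ℕ→ℚ 2 * (α * c (suc n) j + β * d (suc n) j) - (α * c n j + β * d n j)
    ≡⟨ sym (cong₂ _-_ (cong₂ (λ x y → x - ℕ→ℚ 2 * y) (xshift-lincomb j) (e≗ (suc n) j)) (e≗ n j)) ⟩
  xshift (e (suc n)) j - ℕ→ℚ 2 * e (suc n) j - e n j ∎
  where
  open ≡-Reasoning
  regroup : ∀ α β u v x y z w →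
    α * (u - ℕ→ℚ 2 * x - z) + β * (v - ℕ→ℚ 2 * y - w) ≡ (α * u + β * v) - ℕ→ℚ 2 * (α * x + β * y) - (α * z + β * w)
  regroup = solve-∀ ℚ-ring
  α*0+β*0≡0 : ∀ α β → 0ℚ ≡ α * 0ℚ + β * 0ℚ
  α*0+β*0≡0 = solve-∀ ℚ-ring
  xshift-lincomb : ∀ j → xshift (e (suc n)) j ≡ α * xshift (c (suc n)) j + β * xshift (d (suc n)) j
  xshift-lincomb zero    = α*0+β*0≡0 α β
  xshift-lincomb (suc j) = e≗ (suc n) j

coeff-p-recurrent : ∀ b → Recurrent (λ m j → coeff (p b (suc m)) j)
coeff-p-recurrent b n j =
  trans (p-recurrence b (coeff-isLinear j) (suc n))
        (cong₂ (λ x y → x - ℕ→ℚ 2 * coeff (p b (suc (suc n))) j - y) (coeff-shiftX (p b (suc (suc n))) j) (*-identityˡ (coeff (p b (suc n)) j)))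

cheb : ℕ → ℕ → ℚ
cheb n k = sgn n * binom n k

cheb-recurrence : ∀ n k → cheb (suc (suc n)) (suc (suc k)) ≡ cheb n k - ℕ→ℚ 2 * cheb (suc n) (suc (suc k)) - cheb n (suc (suc k))
cheb-recurrence n k = begin
  - 1ℚ * (- 1ℚ * σ) * X         ≡⟨ unfold σ X W ⟩
  σ * ((X + W) - W)             ≡⟨ cong (λ u → σ * (u - W)) (binom-recurrence n k) ⟩
  σ * ((Y + ℕ→ℚ 2 * Z) - W)     ≡⟨ refold σ Y Z W ⟩
  σ * Y - ℕ→ℚ 2 * (- 1ℚ * σ * Z) - σ * W ∎
  where
  open ≡-Reasoning
  σ = sgn n
  X = binom (suc (suc n)) (suc (suc k))
  Y = binom n k
  Z = binom (suc n) (suc (suc k))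
  W = binom n (suc (suc k))
  unfold : ∀ σ X W → - 1ℚ * (- 1ℚ * σ) * X ≡ σ * ((X + W) - W)
  unfold = solve-∀ ℚ-ring
  refold : ∀ σ Y Z W → σ * ((Y + ℕ→ℚ 2 * Z) - W) ≡ σ * Y - ℕ→ℚ 2 * (- 1ℚ * σ * Z) - σ * W
  refold = solve-∀ ℚ-ring

+-<-double : ∀ {n j k} → n < j → 2 ℕ.* j ≤ k → n ℕ.+ j < k
+-<-double {n} {j} n<j 2j≤k =
  ℕₚ.<-≤-trans (ℕₚ.+-monoˡ-< j n<j) (ℕₚ.≤-trans (ℕₚ.≤-reflexive (cong (j ℕ.+_) (sym (ℕₚ.+-identityʳ j)))) 2j≤k)

chebCoeff : ℕ → ℕ → ℕ → ℚ
chebCoeff e n j = cheb (n ℕ.+ j) (e ℕ.+ 2 ℕ.* j)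

chebCoeff-vanish : ∀ e {n j} → n < j → chebCoeff e n j ≡ 0ℚ
chebCoeff-vanish e {n} {j} n<j =
  trans (cong (sgn (n ℕ.+ j) *_) (binom-vanish (+-<-double n<j (ℕₚ.m≤n+m (2 ℕ.* j) e)))) (*-zeroʳ (sgn (n ℕ.+ j)))

e+2[1+j]≡2+[e+2j] : ∀ e j → e ℕ.+ 2 ℕ.* suc j ≡ suc (suc (e ℕ.+ 2 ℕ.* j))
e+2[1+j]≡2+[e+2j] = ℕ-solve-∀

chebCoeff-recurrent : ∀ e → e ≤ 1 → Recurrent (chebCoeff e)
chebCoeff-recurrent zero          _ n zero    = const-term (sgn (n ℕ.+ 0))
  where
  const-term : ∀ σ → - 1ℚ * (- 1ℚ * σ) * ℕ→ℚ 1 ≡ 0ℚ - ℕ→ℚ 2 * (- 1ℚ * σ * ℕ→ℚ 1) - σ * ℕ→ℚ 1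
  const-term = solve-∀ ℚ-ring
chebCoeff-recurrent (suc zero)    _ n zero    = begin
  cheb (suc (suc m)) 1                                     ≡⟨ cong (sgn (suc (suc m)) *_) (trans (cong ℕ→ℚ (nC1≡n (suc (suc m)))) (ℕ→ℚ-+ 2 m)) ⟩
  - 1ℚ * (- 1ℚ * σ) * (ℕ→ℚ 2 + ℕ→ℚ m)                     ≡⟨ linear-term σ (ℕ→ℚ m) ⟩
  0ℚ - ℕ→ℚ 2 * (- 1ℚ * σ * (ℕ→ℚ 1 + ℕ→ℚ m)) - σ * ℕ→ℚ m   ≡⟨ sym (cong₂ (λ x y → 0ℚ - ℕ→ℚ 2 * (- 1ℚ * σ * x) - σ * y)
                                                                      (trans (cong ℕ→ℚ (nC1≡n (suc m))) (ℕ→ℚ-+ 1 m)) (cong ℕ→ℚ (nC1≡n m))) ⟩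
  0ℚ - ℕ→ℚ 2 * cheb (suc m) 1 - cheb m 1                  ∎
  where
  open ≡-Reasoning
  m = n ℕ.+ 0
  σ = sgn m
  linear-term : ∀ σ x → - 1ℚ * (- 1ℚ * σ) * (ℕ→ℚ 2 + x) ≡ 0ℚ - ℕ→ℚ 2 * (- 1ℚ * σ * (ℕ→ℚ 1 + x)) - σ * x
  linear-term = solve-∀ ℚ-ring
chebCoeff-recurrent (suc (suc e)) (s≤s ()) n zero
chebCoeff-recurrent e             _ n (suc j) = begin
  cheb (suc (suc m)) (e ℕ.+ 2 ℕ.* suc j)        ≡⟨ cong (cheb (suc (suc m))) (e+2[1+j]≡2+[e+2j] e j) ⟩
  cheb (suc (suc m)) (suc (suc k))              ≡⟨ cheb-recurrence m k ⟩
  cheb m k - ℕ→ℚ 2 * cheb (suc m) (suc (suc k)) - cheb m (suc (suc k))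
    ≡⟨ cong₂ (λ x y → x - ℕ→ℚ 2 * cheb (suc m) y - cheb m y)
             (cong (λ a → cheb a k) (ℕₚ.+-suc n j)) (sym (e+2[1+j]≡2+[e+2j] e j)) ⟩
  cheb (suc (n ℕ.+ j)) k - ℕ→ℚ 2 * cheb (suc m) (e ℕ.+ 2 ℕ.* suc j) - cheb m (e ℕ.+ 2 ℕ.* suc j) ∎
  where
  open ≡-Reasoning
  m = n ℕ.+ suc j
  k = e ℕ.+ 2 ℕ.* j

-- the coefficient of x^j in the closed form (i) of p_(m+1), after binom-ratio
closedForm : ℚ → ℕ → ℕ → ℚ
closedForm b m j = (chebCoeff 0 (suc m) j - chebCoeff 0 m j) + b * (chebCoeff 1 (suc m) j - chebCoeff 1 m j)

closedForm-recurrent : ∀ b → Recurrent (closedForm b)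
closedForm-recurrent b = Recurrent-lincomb 1ℚ b (difference 0 z≤n) (difference 1 (s≤s z≤n))
  (λ n j → 1*x+b*y b (chebCoeff 0 (suc n) j - chebCoeff 0 n j) (chebCoeff 1 (suc n) j - chebCoeff 1 n j))
  where
  x-y≡1*x+[-1]*y : ∀ x y → x - y ≡ 1ℚ * x + (- 1ℚ) * y
  x-y≡1*x+[-1]*y = solve-∀ ℚ-ring
  1*x+b*y : ∀ b x y → x + b * y ≡ 1ℚ * x + b * y
  1*x+b*y = solve-∀ ℚ-ring
  difference : ∀ e → e ≤ 1 → Recurrent (λ m j → chebCoeff e (suc m) j - chebCoeff e m j)
  difference e e≤1 = Recurrent-lincomb 1ℚ (- 1ℚ) (λ n → chebCoeff-recurrent e e≤1 (suc n)) (chebCoeff-recurrent e e≤1)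
                       (λ n j → x-y≡1*x+[-1]*y (chebCoeff e (suc n) j) (chebCoeff e n j))

closedForm-vanish : ∀ b m j → suc m < j → closedForm b m j ≡ 0ℚ
closedForm-vanish b m j 1+m<j = begin
  (chebCoeff 0 (suc m) j - chebCoeff 0 m j) + b * (chebCoeff 1 (suc m) j - chebCoeff 1 m j)
    ≡⟨ cong₂ (λ x y → x + b * y) (cong₂ _-_ (chebCoeff-vanish 0 1+m<j) (chebCoeff-vanish 0 m<j))
                                  (cong₂ _-_ (chebCoeff-vanish 1 1+m<j) (chebCoeff-vanish 1 m<j)) ⟩
  (0ℚ - 0ℚ) + b * (0ℚ - 0ℚ) ≡⟨ zeros b ⟩
  0ℚ ∎
  where
  open ≡-Reasoning
  m<j = ℕₚ.<-trans (ℕₚ.n<1+n m) 1+m<j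
  zeros : ∀ b → (0ℚ - 0ℚ) + b * (0ℚ - 0ℚ) ≡ 0ℚ
  zeros = solve-∀ ℚ-ring

p₁≡closedForm : ∀ b j → coeff (p b 1) j ≡ closedForm b 0 j
p₁≡closedForm b zero          = constant b
  where
  constant : ∀ b → 0ℚ + (- (b + ℕ→ℚ 2)) * 1ℚ ≡ - ℕ→ℚ 2 + b * - 1ℚ
  constant = solve-∀ ℚ-ring
p₁≡closedForm b (suc zero)    = monic b
  where
  monic : ∀ b → 1ℚ ≡ 1ℚ + b * 0ℚ
  monic = solve-∀ ℚ-ring
p₁≡closedForm b (suc (suc j)) = trans (coeff-p-vanish b 1 (suc (suc j)) (s≤s (s≤s z≤n)))
                                      (sym (closedForm-vanish b 0 (suc (suc j)) (s≤s (s≤s z≤n))))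

p₂≡closedForm : ∀ b j → coeff (p b 2) j ≡ closedForm b 1 j
p₂≡closedForm b zero                = constant b
  where
  constant : ∀ b → (0ℚ + (- ℕ→ℚ 2) * (0ℚ + (- (b + ℕ→ℚ 2)) * 1ℚ)) + (- (ℕ→ℚ 2 - b)) * 1ℚ ≡ ℕ→ℚ 2 + b * ℕ→ℚ 3
  constant = solve-∀ ℚ-ring
p₂≡closedForm b (suc zero)          = linear b
  where
  linear : ∀ b → (0ℚ + (- (b + ℕ→ℚ 2)) * 1ℚ) + (- ℕ→ℚ 2) * 1ℚ ≡ - ℕ→ℚ 4 + b * - 1ℚ
  linear = solve-∀ ℚ-ring
p₂≡closedForm b (suc (suc zero))    = monic b
  where
  monic : ∀ b → 1ℚ ≡ 1ℚ + b * 0ℚ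
  monic = solve-∀ ℚ-ring
p₂≡closedForm b (suc (suc (suc j))) = trans (coeff-p-vanish b 2 (suc (suc (suc j))) (s≤s (s≤s (s≤s z≤n))))
                                            (sym (closedForm-vanish b 1 (suc (suc (suc j))) (s≤s (s≤s (s≤s z≤n)))))

coeff-p≡closedForm : ∀ b m j → coeff (p b (suc m)) j ≡ closedForm b m j
coeff-p≡closedForm b = Recurrent-unique (coeff-p-recurrent b) (closedForm-recurrent b) (p₁≡closedForm b) (p₂≡closedForm b)

sgn-binom-sum : ∀ m j k → 2 ℕ.* j ≤ k →
  sgn (suc m ℕ.∸ j) * (binom (suc m ℕ.+ j) k + binom (m ℕ.+ j) k) ≡ cheb (suc m ℕ.+ j) k - cheb (m ℕ.+ j) k
sgn-binom-sum m j k 2j≤k = [ in-range , out-of-range ]′ (ℕₚ.≤-<-connex j (suc m))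
  where
  open ≡-Reasoning
  x = binom (suc m ℕ.+ j) k
  y = binom (m ℕ.+ j) k
  alternate : ∀ σ x y → - 1ℚ * σ * (x + y) ≡ - 1ℚ * σ * x - σ * y
  alternate = solve-∀ ℚ-ring
  zeros : ∀ σ τ υ → σ * (0ℚ + 0ℚ) ≡ τ * 0ℚ - υ * 0ℚ
  zeros = solve-∀ ℚ-ring
  in-range : j ≤ suc m → sgn (suc m ℕ.∸ j) * (x + y) ≡ cheb (suc m ℕ.+ j) k - cheb (m ℕ.+ j) k
  in-range j≤1+m = trans (cong (_* (x + y)) (sgn-∸≡sgn-+ j≤1+m)) (alternate (sgn (m ℕ.+ j)) x y)
  out-of-range : suc m < j → sgn (suc m ℕ.∸ j) * (x + y) ≡ cheb (suc m ℕ.+ j) k - cheb (m ℕ.+ j) k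
  out-of-range 1+m<j = begin
    sgn (suc m ℕ.∸ j) * (x + y)                     ≡⟨ cong₂ (λ u v → sgn (suc m ℕ.∸ j) * (u + v)) x≡0 y≡0 ⟩
    sgn (suc m ℕ.∸ j) * (0ℚ + 0ℚ)                   ≡⟨ zeros (sgn (suc m ℕ.∸ j)) (sgn (suc m ℕ.+ j)) (sgn (m ℕ.+ j)) ⟩
    sgn (suc m ℕ.+ j) * 0ℚ - sgn (m ℕ.+ j) * 0ℚ     ≡⟨ sym (cong₂ (λ u v → sgn (suc m ℕ.+ j) * u - sgn (m ℕ.+ j) * v) x≡0 y≡0) ⟩
    sgn (suc m ℕ.+ j) * x - sgn (m ℕ.+ j) * y       ∎
    where
    x≡0 : x ≡ 0ℚ
    x≡0 = binom-vanish (+-<-double 1+m<j 2j≤k)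
    y≡0 : y ≡ 0ℚ
    y≡0 = binom-vanish (+-<-double (ℕₚ.<-trans (ℕₚ.n<1+n m) 1+m<j) 2j≤k)

closedCoeff≡closedForm : ∀ b m j → closedCoeff b m j ≡ closedForm b m j
closedCoeff≡closedForm b m j = begin
  closedCoeff b m j
    ≡⟨ cong₂ (λ x y → σ * x + b * (σ * y))
             (binom-ratio (m ℕ.+ j) (2 ℕ.* j) (2 ℕ.* suc m) (weights₀ m j))
             (binom-ratio (m ℕ.+ j) (suc (2 ℕ.* j)) (2 ℕ.* suc m ℕ.∸ 1) (weights₁ m j)) ⟩
  σ * (binom (suc m ℕ.+ j) (2 ℕ.* j) + binom (m ℕ.+ j) (2 ℕ.* j))
    + b * (σ * (binom (suc m ℕ.+ j) (suc (2 ℕ.* j)) + binom (m ℕ.+ j) (suc (2 ℕ.* j))))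
    ≡⟨ cong₂ (λ x y → x + b * y) (sgn-binom-sum m j (2 ℕ.* j) ℕₚ.≤-refl) (sgn-binom-sum m j (suc (2 ℕ.* j)) (ℕₚ.n≤1+n _)) ⟩
  closedForm b m j ∎
  where
  open ≡-Reasoning
  σ = sgn (suc m ℕ.∸ j)
  weights₀ : ∀ m j → 2 ℕ.* suc m ℕ.+ 2 ℕ.* j ≡ 2 ℕ.* suc (m ℕ.+ j)
  weights₀ = ℕ-solve-∀
  weights₁′ : ∀ m j → suc (2 ℕ.* m) ℕ.+ suc (2 ℕ.* j) ≡ 2 ℕ.* suc (m ℕ.+ j)
  weights₁′ = ℕ-solve-∀
  weights₁ : ∀ m j → 2 ℕ.* suc m ℕ.∸ 1 ℕ.+ suc (2 ℕ.* j) ≡ 2 ℕ.* suc (m ℕ.+ j)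
  weights₁ m j = trans (cong (ℕ._+ suc (2 ℕ.* j)) (ℕₚ.+-suc m (m ℕ.+ 0))) (weights₁′ m j)

-- The moments (ii)

-- F j f plays the role of Λ(x^j f)
record IsShiftFamily (F : ℕ → Poly → ℚ) : Set where
  field
    isLinear : ∀ j → IsLinear (F j)
    shift    : ∀ j f → F j (shiftX f) ≡ F (suc j) f

-- mixedMoment b n k = Λ(x^n p_k); the recursion is x p_k = p_(k+1) + s_k p_k + t_(k-1) p_(k-1)
mixedMoment : ℚ → ℕ → ℕ → ℚ
mixedMoment b zero    k       = iverson0 k
mixedMoment b (suc n) zero    = mixedMoment b n 1 + s b 0 * mixedMoment b n 0
mixedMoment b (suc n) (suc k) = mixedMoment b n (suc (suc k)) + s b (suc k) * mixedMoment b n (suc k) + t b k * mixedMoment b n k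

module _ (b : ℚ) {F : ℕ → Poly → ℚ} (family : IsShiftFamily F) where
  open IsShiftFamily family

  shiftFamily-fromOrthogonality : (∀ k → F 0 (p b k) ≡ iverson0 k) → ∀ n k → F n (p b k) ≡ mixedMoment b n k
  shiftFamily-fromOrthogonality F₀ zero    k       = F₀ k
  shiftFamily-fromOrthogonality F₀ (suc n) zero    = begin
    F (suc n) (p b 0)                                  ≡⟨ sym (shift n (p b 0)) ⟩
    F n (shiftX (p b 0))                               ≡⟨ x≡[x-y]+y (F n (shiftX (p b 0))) (s b 0 * F n (p b 0)) ⟩
    (F n (shiftX (p b 0)) - s b 0 * F n (p b 0)) + s b 0 * F n (p b 0)
      ≡⟨ cong (_+ s b 0 * F n (p b 0)) (sym (p-recurrence₁ b (isLinear n))) ⟩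
    F n (p b 1) + s b 0 * F n (p b 0)                  ≡⟨ cong₂ (λ u v → u + s b 0 * v) (IH 1) (IH 0) ⟩
    mixedMoment b n 1 + s b 0 * mixedMoment b n 0      ∎
    where
    open ≡-Reasoning
    IH = shiftFamily-fromOrthogonality F₀ n
    x≡[x-y]+y : ∀ x y → x ≡ (x - y) + y
    x≡[x-y]+y = solve-∀ ℚ-ring
  shiftFamily-fromOrthogonality F₀ (suc n) (suc k) = begin
    F (suc n) (p b (suc k))                                   ≡⟨ sym (shift n (p b (suc k))) ⟩
    F n (shiftX (p b (suc k)))                                ≡⟨ x≡[x-y-z]+y+z (F n (shiftX (p b (suc k)))) (s b (suc k) * F n (p b (suc k))) (t b k * F n (p b k)) ⟩
    (F n (shiftX (p b (suc k))) - s b (suc k) * F n (p b (suc k)) - t b k * F n (p b k)) + s b (suc k) * F n (p b (suc k)) + t b k * F n (p b k)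
      ≡⟨ cong (λ u → u + s b (suc k) * F n (p b (suc k)) + t b k * F n (p b k)) (sym (p-recurrence b (isLinear n) k)) ⟩
    F n (p b (suc (suc k))) + s b (suc k) * F n (p b (suc k)) + t b k * F n (p b k)
      ≡⟨ cong₂ (λ u v → u + s b (suc k) * v + t b k * F n (p b k)) (IH (suc (suc k))) (IH (suc k)) ⟩
    mixedMoment b n (suc (suc k)) + s b (suc k) * mixedMoment b n (suc k) + t b k * F n (p b k)
      ≡⟨ cong (λ w → mixedMoment b n (suc (suc k)) + s b (suc k) * mixedMoment b n (suc k) + t b k * w) (IH k) ⟩
    mixedMoment b n (suc (suc k)) + s b (suc k) * mixedMoment b n (suc k) + t b k * mixedMoment b n k ∎
    where
    open ≡-Reasoning
    IH = shiftFamily-fromOrthogonality F₀ n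
    x≡[x-y-z]+y+z : ∀ x y z → x ≡ (x - y - z) + y + z
    x≡[x-y-z]+y+z = solve-∀ ℚ-ring

  shiftFamily-fromMoments : (∀ j → F j (p b 0) ≡ mixedMoment b j 0) → ∀ k j → F j (p b k) ≡ mixedMoment b j k
  shiftFamily-fromMoments F₀ zero          j = F₀ j
  shiftFamily-fromMoments F₀ (suc zero)    j = begin
    F j (p b 1)                                                     ≡⟨ p-recurrence₁ b (isLinear j) ⟩
    F j (shiftX (p b 0)) - s b 0 * F j (p b 0)                      ≡⟨ cong₂ (λ u v → u - s b 0 * v) (trans (shift j (p b 0)) (F₀ (suc j))) (F₀ j) ⟩
    (mixedMoment b j 1 + s b 0 * mixedMoment b j 0) - s b 0 * mixedMoment b j 0 ≡⟨ [x+y]-y≡x (mixedMoment b j 1) (s b 0 * mixedMoment b j 0) ⟩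
    mixedMoment b j 1                                               ∎
    where
    open ≡-Reasoning
    [x+y]-y≡x : ∀ x y → (x + y) - y ≡ x
    [x+y]-y≡x = solve-∀ ℚ-ring
  shiftFamily-fromMoments F₀ (suc (suc k)) j = begin
    F j (p b (suc (suc k)))
      ≡⟨ p-recurrence b (isLinear j) k ⟩
    F j (shiftX (p b (suc k))) - s b (suc k) * F j (p b (suc k)) - t b k * F j (p b k)
      ≡⟨ cong₂ (λ u v → u - s b (suc k) * v - t b k * F j (p b k))
               (trans (shift j (p b (suc k))) (shiftFamily-fromMoments F₀ (suc k) (suc j))) (shiftFamily-fromMoments F₀ (suc k) j) ⟩
    mixedMoment b (suc j) (suc k) - s b (suc k) * mixedMoment b j (suc k) - t b k * F j (p b k)
      ≡⟨ cong (λ w → mixedMoment b (suc j) (suc k) - s b (suc k) * mixedMoment b j (suc k) - t b k * w) (shiftFamily-fromMoments F₀ k j) ⟩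
    (mixedMoment b j (suc (suc k)) + y + z) - y - z
      ≡⟨ [x+y+z]-y-z≡x (mixedMoment b j (suc (suc k))) y z ⟩
    mixedMoment b j (suc (suc k)) ∎
    where
    open ≡-Reasoning
    y = s b (suc k) * mixedMoment b j (suc k)
    z = t b k * mixedMoment b j k
    [x+y+z]-y-z≡x : ∀ x y z → (x + y + z) - y - z ≡ x
    [x+y+z]-y-z≡x = solve-∀ ℚ-ring

binom-pascal² : ∀ n k → binom (suc (suc n)) (suc (suc k)) ≡ binom n (suc (suc k)) + ℕ→ℚ 2 * binom n (suc k) + binom n k
binom-pascal² n k = begin
  binom (suc (suc n)) (suc (suc k))   ≡⟨ trans (binom-pascal (suc n) (suc k)) (cong₂ _+_ (binom-pascal n k) (binom-pascal n (suc k))) ⟩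
  (x + y) + (y + z)                   ≡⟨ regroup x y z ⟩
  z + ℕ→ℚ 2 * y + x                   ∎
  where
  open ≡-Reasoning
  x = binom n k
  y = binom n (suc k)
  z = binom n (suc (suc k))
  regroup : ∀ x y z → (x + y) + (y + z) ≡ z + ℕ→ℚ 2 * y + x
  regroup = solve-∀ ℚ-ring

binomSum : ℚ → ℕ → ℕ → ℚ
binomSum b n k = horner b n (λ j → binom (n ℕ.+ j) (n ℕ.+ k))

binomSum-suc-suc : ∀ b n k → binomSum b (suc n) (suc k) ≡ binomSum b n (suc (suc k)) + ℕ→ℚ 2 * binomSum b n (suc k) + binomSum b n k
binomSum-suc-suc b n k = begin
  horner b (suc n) (λ j → binom (suc n ℕ.+ j) (suc n ℕ.+ suc k))
    ≡⟨ horner-head b n (λ j → binom (suc n ℕ.+ j) (suc n ℕ.+ suc k)) ⟩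
  binom (suc n ℕ.+ 0) (suc n ℕ.+ suc k) * b ^ℚ suc n + horner b n (λ j → binom (suc n ℕ.+ suc j) (suc n ℕ.+ suc k))
    ≡⟨ cong₂ _+_ (trans (cong (_* b ^ℚ suc n) (binom-vanish (ℕₚ.+-monoʳ-< (suc n) (s≤s z≤n)))) (*-zeroˡ (b ^ℚ suc n)))
                 (horner-cong b n termwise) ⟩
  0ℚ + horner b n (λ j → f (suc (suc k)) j + ℕ→ℚ 2 * f (suc k) j + f k j)
    ≡⟨ +-identityˡ _ ⟩
  horner b n (λ j → f (suc (suc k)) j + ℕ→ℚ 2 * f (suc k) j + f k j)
    ≡⟨ horner-+ b n (λ j → f (suc (suc k)) j + ℕ→ℚ 2 * f (suc k) j) (f k) ⟩
  horner b n (λ j → f (suc (suc k)) j + ℕ→ℚ 2 * f (suc k) j) + binomSum b n k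
    ≡⟨ cong (_+ binomSum b n k) (trans (horner-+ b n (f (suc (suc k))) (λ j → ℕ→ℚ 2 * f (suc k) j))
                                       (cong (binomSum b n (suc (suc k)) +_) (horner-* b n (ℕ→ℚ 2) (f (suc k))))) ⟩
  binomSum b n (suc (suc k)) + ℕ→ℚ 2 * binomSum b n (suc k) + binomSum b n k ∎
  where
  open ≡-Reasoning
  f : ℕ → ℕ → ℚ
  f k j = binom (n ℕ.+ j) (n ℕ.+ k)
  termwise : ∀ j → binom (suc n ℕ.+ suc j) (suc n ℕ.+ suc k) ≡ f (suc (suc k)) j + ℕ→ℚ 2 * f (suc k) j + f k j
  termwise j = begin
    binom (suc n ℕ.+ suc j) (suc n ℕ.+ suc k)
      ≡⟨ cong₂ binom (cong suc (ℕₚ.+-suc n j)) (cong suc (ℕₚ.+-suc n k)) ⟩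
    binom (suc (suc (n ℕ.+ j))) (suc (suc (n ℕ.+ k)))
      ≡⟨ binom-pascal² (n ℕ.+ j) (n ℕ.+ k) ⟩
    binom (n ℕ.+ j) (suc (suc (n ℕ.+ k))) + ℕ→ℚ 2 * binom (n ℕ.+ j) (suc (n ℕ.+ k)) + f k j
      ≡⟨ sym (cong₂ (λ u v → binom (n ℕ.+ j) u + ℕ→ℚ 2 * binom (n ℕ.+ j) v + f k j)
                    (trans (ℕₚ.+-suc n (suc k)) (cong suc (ℕₚ.+-suc n k))) (ℕₚ.+-suc n k)) ⟩
    f (suc (suc k)) j + ℕ→ℚ 2 * f (suc k) j + f k j ∎

binom-middle-sym : ∀ n → binom (n ℕ.+ suc n) (n ℕ.+ 1) ≡ binom (n ℕ.+ suc n) (n ℕ.+ 0)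
binom-middle-sym n = cong ℕ→ℚ (begin
  N C (n ℕ.+ 1)         ≡⟨ cong (N C_) (ℕₚ.+-comm n 1) ⟩
  N C suc n             ≡⟨ nCk≡nC[n∸k] (ℕₚ.m≤n+m (suc n) n) ⟩
  N C (N ℕ.∸ suc n)     ≡⟨ cong (N C_) (trans (ℕₚ.m+n∸n≡m n (suc n)) (sym (ℕₚ.+-identityʳ n))) ⟩
  N C (n ℕ.+ 0)         ∎)
  where
  open ≡-Reasoning
  N = n ℕ.+ suc n

ballot : ℕ → ℕ → ℚ
ballot n j = binom (n ℕ.+ j) (n ℕ.+ 0) - binom (n ℕ.+ j) (n ℕ.+ 1)

ballot-zero : ∀ n → ballot n 0 ≡ 1ℚ
ballot-zero n = cong₂ _-_ (binom-diag (n ℕ.+ 0)) (binom-vanish (ℕₚ.+-monoʳ-< n (s≤s z≤n)))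

ballot-last : ∀ n → ballot n (suc n) ≡ 0ℚ
ballot-last n = trans (cong (λ x → binom (n ℕ.+ suc n) (n ℕ.+ 0) - x) (binom-middle-sym n))
                      (+-inverseʳ (binom (n ℕ.+ suc n) (n ℕ.+ 0)))

binom-ballot-split : ∀ n j →
  binom (suc n ℕ.+ suc j) (suc n ℕ.+ 0) ≡ ℕ→ℚ 2 * (binom (n ℕ.+ j) (n ℕ.+ 0) + binom (n ℕ.+ j) (n ℕ.+ 1)) + ballot n (suc j)
binom-ballot-split n j = begin
  binom (suc N) (suc n₀)                                   ≡⟨ binom-pascal N n₀ ⟩
  binom N n₀ + binom N (suc n₀)                            ≡⟨ x+y≡2*y+[x-y] (binom N n₀) (binom N (suc n₀)) ⟩
  ℕ→ℚ 2 * binom N (suc n₀) + (binom N n₀ - binom N (suc n₀))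
    ≡⟨ cong₂ (λ u v → ℕ→ℚ 2 * u + (binom N n₀ - binom N v)) upper (sym n+1≡1+n₀) ⟩
  ℕ→ℚ 2 * (binom (n ℕ.+ j) n₀ + binom (n ℕ.+ j) (n ℕ.+ 1)) + ballot n (suc j) ∎
  where
  open ≡-Reasoning
  N  = n ℕ.+ suc j
  n₀ = n ℕ.+ 0
  n+1≡1+n₀ : n ℕ.+ 1 ≡ suc n₀
  n+1≡1+n₀ = ℕₚ.+-suc n 0
  x+y≡2*y+[x-y] : ∀ x y → x + y ≡ ℕ→ℚ 2 * y + (x - y)
  x+y≡2*y+[x-y] = solve-∀ ℚ-ring
  upper : binom N (suc n₀) ≡ binom (n ℕ.+ j) n₀ + binom (n ℕ.+ j) (n ℕ.+ 1)
  upper = begin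
    binom N (suc n₀)                                    ≡⟨ cong (λ a → binom a (suc n₀)) (ℕₚ.+-suc n j) ⟩
    binom (suc (n ℕ.+ j)) (suc n₀)                      ≡⟨ binom-pascal (n ℕ.+ j) n₀ ⟩
    binom (n ℕ.+ j) n₀ + binom (n ℕ.+ j) (suc n₀)       ≡⟨ cong (λ k → binom (n ℕ.+ j) n₀ + binom (n ℕ.+ j) k) (sym n+1≡1+n₀) ⟩
    binom (n ℕ.+ j) n₀ + binom (n ℕ.+ j) (n ℕ.+ 1)      ∎

-- the ballot terms form a Horner shift of G₀ - G₁, which produces the terms in b
binomSum-suc-zero : ∀ b n → binomSum b (suc n) 0 ≡ (ℕ→ℚ 2 - b) * binomSum b n 1 + s b 0 * binomSum b n 0
binomSum-suc-zero b n = begin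
  horner b (suc n) (λ j → binom (suc n ℕ.+ j) (suc n ℕ.+ 0))
    ≡⟨ horner-head b n (λ j → binom (suc n ℕ.+ j) (suc n ℕ.+ 0)) ⟩
  binom (suc n ℕ.+ 0) (suc n ℕ.+ 0) * b ^ℚ suc n + horner b n (λ j → binom (suc n ℕ.+ suc j) (suc n ℕ.+ 0))
    ≡⟨ cong₂ _+_ (cong (_* b ^ℚ suc n) (trans (binom-diag (suc n ℕ.+ 0)) (sym (ballot-zero n))))
                 (horner-cong b n (binom-ballot-split n)) ⟩
  ballot n 0 * b ^ℚ suc n + horner b n (λ j → ℕ→ℚ 2 * (f₀ j + f₁ j) + ballot n (suc j))
    ≡⟨ cong (ballot n 0 * b ^ℚ suc n +_) (trans (horner-+ b n (λ j → ℕ→ℚ 2 * (f₀ j + f₁ j)) (ballot n ∘ suc))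
                                               (cong (_+ horner b n (ballot n ∘ suc)) (horner-* b n (ℕ→ℚ 2) (λ j → f₀ j + f₁ j)))) ⟩
  ballot n 0 * b ^ℚ suc n + (ℕ→ℚ 2 * horner b n (λ j → f₀ j + f₁ j) + horner b n (ballot n ∘ suc))
    ≡⟨ +-left-comm (ballot n 0 * b ^ℚ suc n) (ℕ→ℚ 2 * horner b n (λ j → f₀ j + f₁ j)) (horner b n (ballot n ∘ suc)) ⟩
  ℕ→ℚ 2 * horner b n (λ j → f₀ j + f₁ j) + (ballot n 0 * b ^ℚ suc n + horner b n (ballot n ∘ suc))
    ≡⟨ cong₂ (λ u v → ℕ→ℚ 2 * u + v) (horner-+ b n f₀ f₁) (sym (horner-head b n (ballot n))) ⟩
  ℕ→ℚ 2 * (G₀ + G₁) + horner b (suc n) (ballot n)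
    ≡⟨ cong (ℕ→ℚ 2 * (G₀ + G₁) +_) (horner-suc b n (ballot n)) ⟩
  ℕ→ℚ 2 * (G₀ + G₁) + (b * horner b n (ballot n) + ballot n (suc n))
    ≡⟨ cong₂ (λ u v → ℕ→ℚ 2 * (G₀ + G₁) + (b * u + v)) (horner-- b n f₀ f₁) (ballot-last n) ⟩
  ℕ→ℚ 2 * (G₀ + G₁) + (b * (G₀ - G₁) + 0ℚ)
    ≡⟨ collect b G₀ G₁ ⟩
  (ℕ→ℚ 2 - b) * G₁ + (b + ℕ→ℚ 2) * G₀ ∎
  where
  open ≡-Reasoning
  f₀ f₁ : ℕ → ℚ
  f₀ j = binom (n ℕ.+ j) (n ℕ.+ 0)
  f₁ j = binom (n ℕ.+ j) (n ℕ.+ 1)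
  G₀ = binomSum b n 0
  G₁ = binomSum b n 1
  collect : ∀ b G₀ G₁ → ℕ→ℚ 2 * (G₀ + G₁) + (b * (G₀ - G₁) + 0ℚ) ≡ (ℕ→ℚ 2 - b) * G₁ + (b + ℕ→ℚ 2) * G₀
  collect = solve-∀ ℚ-ring

mixedMomentClosed : ℚ → ℕ → ℕ → ℚ
mixedMomentClosed b n zero    = binomSum b n 0
mixedMomentClosed b n (suc k) = (ℕ→ℚ 2 - b) * binomSum b n (suc k)

t*mixedMomentClosed : ∀ b n k → t b k * mixedMomentClosed b n k ≡ (ℕ→ℚ 2 - b) * binomSum b n k
t*mixedMomentClosed b n zero    = refl
t*mixedMomentClosed b n (suc k) = *-identityˡ ((ℕ→ℚ 2 - b) * binomSum b n (suc k))

mixedMoment≡closed : ∀ b n k → mixedMoment b n k ≡ mixedMomentClosed b n k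
mixedMoment≡closed b zero    zero    = refl
mixedMoment≡closed b zero    (suc k) = sym (*-zeroʳ (ℕ→ℚ 2 - b))
mixedMoment≡closed b (suc n) zero    =
  trans (cong₂ (λ u v → u + s b 0 * v) (mixedMoment≡closed b n 1) (mixedMoment≡closed b n 0)) (sym (binomSum-suc-zero b n))
mixedMoment≡closed b (suc n) (suc k) = begin
  mixedMoment b n (suc (suc k)) + ℕ→ℚ 2 * mixedMoment b n (suc k) + t b k * mixedMoment b n k
    ≡⟨ cong₂ (λ u v → u + ℕ→ℚ 2 * v + t b k * mixedMoment b n k) (mixedMoment≡closed b n (suc (suc k))) (mixedMoment≡closed b n (suc k)) ⟩
  c * binomSum b n (suc (suc k)) + ℕ→ℚ 2 * (c * binomSum b n (suc k)) + t b k * mixedMoment b n k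
    ≡⟨ cong (λ w → c * binomSum b n (suc (suc k)) + ℕ→ℚ 2 * (c * binomSum b n (suc k)) + w)
            (trans (cong (t b k *_) (mixedMoment≡closed b n k)) (t*mixedMomentClosed b n k)) ⟩
  c * binomSum b n (suc (suc k)) + ℕ→ℚ 2 * (c * binomSum b n (suc k)) + c * binomSum b n k
    ≡⟨ factor c (binomSum b n (suc (suc k))) (binomSum b n (suc k)) (binomSum b n k) ⟩
  c * (binomSum b n (suc (suc k)) + ℕ→ℚ 2 * binomSum b n (suc k) + binomSum b n k)
    ≡⟨ cong (c *_) (sym (binomSum-suc-suc b n k)) ⟩
  c * binomSum b (suc n) (suc k) ∎
  where
  open ≡-Reasoning
  c = ℕ→ℚ 2 - b
  factor : ∀ c x y z → c * x + ℕ→ℚ 2 * (c * y) + c * z ≡ c * (x + ℕ→ℚ 2 * y + z)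
  factor = solve-∀ ℚ-ring

mixedMoment-0≡M : ∀ b n → mixedMoment b n 0 ≡ M b n
mixedMoment-0≡M b n = trans (mixedMoment≡closed b n 0) (horner-cong b n λ j → cong ℕ→ℚ (begin
  (n ℕ.+ j) C (n ℕ.+ 0)               ≡⟨ cong ((n ℕ.+ j) C_) (ℕₚ.+-identityʳ n) ⟩
  (n ℕ.+ j) C n                       ≡⟨ nCk≡nC[n∸k] (ℕₚ.m≤m+n n j) ⟩
  (n ℕ.+ j) C (n ℕ.+ j ℕ.∸ n)         ≡⟨ cong ((n ℕ.+ j) C_) (ℕₚ.m+n∸m≡n n j) ⟩
  (n ℕ.+ j) C j                       ∎))
  where open ≡-Reasoning

mixedMoment-vanish : ∀ b n k → n < k → mixedMoment b n k ≡ 0ℚ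
mixedMoment-vanish b zero    (suc k) _         = refl
mixedMoment-vanish b (suc n) (suc k) (s≤s n<k) = begin
  mixedMoment b n (suc (suc k)) + s b (suc k) * mixedMoment b n (suc k) + t b k * mixedMoment b n k
    ≡⟨ cong₂ (λ u v → u + s b (suc k) * v + t b k * mixedMoment b n k)
             (mixedMoment-vanish b n (suc (suc k)) (ℕₚ.m<n⇒m<1+n (ℕₚ.m<n⇒m<1+n n<k)))
             (mixedMoment-vanish b n (suc k) (ℕₚ.m<n⇒m<1+n n<k)) ⟩
  0ℚ + s b (suc k) * 0ℚ + t b k * mixedMoment b n k
    ≡⟨ cong (λ w → 0ℚ + s b (suc k) * 0ℚ + t b k * w) (mixedMoment-vanish b n k n<k) ⟩
  0ℚ + s b (suc k) * 0ℚ + t b k * 0ℚ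
    ≡⟨ zeros (s b (suc k)) (t b k) ⟩
  0ℚ ∎
  where
  open ≡-Reasoning
  zeros : ∀ a c → 0ℚ + a * 0ℚ + c * 0ℚ ≡ 0ℚ
  zeros = solve-∀ ℚ-ring

mixedMoment-diag : ∀ b o → mixedMoment b (suc o) (suc o) ≡ ℕ→ℚ 2 - b
mixedMoment-diag b o = begin
  mixedMoment b o (suc (suc o)) + s b (suc o) * mixedMoment b o (suc o) + t b o * mixedMoment b o o
    ≡⟨ cong₂ (λ u v → u + s b (suc o) * v + t b o * mixedMoment b o o)
             (mixedMoment-vanish b o (suc (suc o)) (ℕₚ.m<n⇒m<1+n ℕₚ.≤-refl)) (mixedMoment-vanish b o (suc o) ℕₚ.≤-refl) ⟩
  0ℚ + s b (suc o) * 0ℚ + t b o * mixedMoment b o o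
    ≡⟨ zeros (s b (suc o)) (t b o * mixedMoment b o o) ⟩
  t b o * mixedMoment b o o
    ≡⟨ t*diagonal o ⟩
  ℕ→ℚ 2 - b ∎
  where
  open ≡-Reasoning
  zeros : ∀ a x → 0ℚ + a * 0ℚ + x ≡ x
  zeros = solve-∀ ℚ-ring
  t*diagonal : ∀ o → t b o * mixedMoment b o o ≡ ℕ→ℚ 2 - b
  t*diagonal zero    = *-identityʳ (ℕ→ℚ 2 - b)
  t*diagonal (suc o) = trans (*-identityˡ _) (mixedMoment-diag b o)

shiftXⁿ : ℕ → Poly → Poly
shiftXⁿ zero    f = f
shiftXⁿ (suc n) f = shiftX (shiftXⁿ n f)

shiftXⁿ-shiftX : ∀ n f → shiftXⁿ n (shiftX f) ≡ shiftXⁿ (suc n) f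
shiftXⁿ-shiftX zero    f = refl
shiftXⁿ-shiftX (suc n) f = cong shiftX (shiftXⁿ-shiftX n f)

shiftXⁿ-⊕ : ∀ n f g → shiftXⁿ n (f ⊕ g) ≡ shiftXⁿ n f ⊕ shiftXⁿ n g
shiftXⁿ-⊕ zero    f g = refl
shiftXⁿ-⊕ (suc n) f g = cong (λ h → 0ℚ ∷ h) (shiftXⁿ-⊕ n f g)

shiftXⁿ-· : ∀ n a f → shiftXⁿ n (a · f) ≡ a · shiftXⁿ n f
shiftXⁿ-· zero    a f = refl
shiftXⁿ-· (suc n) a f = cong₂ _∷_ (sym (*-zeroʳ a)) (shiftXⁿ-· n a f)

X^≡shiftXⁿ : ∀ n → X^ n ≡ shiftXⁿ n (X^ 0)
X^≡shiftXⁿ zero    = refl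
X^≡shiftXⁿ (suc n) = cong shiftX (X^≡shiftXⁿ n)

shiftXⁿ-shiftFamily : ∀ {L} → IsLinear L → IsShiftFamily (λ j f → L (shiftXⁿ j f))
shiftXⁿ-shiftFamily {L} L-linear = record
  { isLinear = λ j → record
    { additive    = λ f g → trans (cong L (shiftXⁿ-⊕ j f g)) (additive (shiftXⁿ j f) (shiftXⁿ j g))
    ; homogeneous = λ a f → trans (cong L (shiftXⁿ-· j a f)) (homogeneous a (shiftXⁿ j f))
    }
  ; shift = λ j f → cong L (shiftXⁿ-shiftX j f)
  }
  where open IsLinear L-linear

moments-from-orthogonality : ∀ b (L : Poly → ℚ) → IsLinear L → (∀ n → L (p b n) ≡ iverson0 n) → ∀ n → L (X^ n) ≡ M b n
moments-from-orthogonality b L L-linear L-orth n = begin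
  L (X^ n)                   ≡⟨ cong L (X^≡shiftXⁿ n) ⟩
  L (shiftXⁿ n (p b 0))      ≡⟨ shiftFamily-fromOrthogonality b (shiftXⁿ-shiftFamily L-linear) L-orth n 0 ⟩
  mixedMoment b n 0          ≡⟨ mixedMoment-0≡M b n ⟩
  M b n                      ∎
  where open ≡-Reasoning

-- The Hankel determinant (iii)

Λ : (ℕ → ℚ) → Poly → ℚ
Λ m []      = 0ℚ
Λ m (c ∷ f) = c * m 0 + Λ (m ∘ suc) f

Λ-cong : ∀ {m m′} → (∀ r → m r ≡ m′ r) → ∀ f → Λ m f ≡ Λ m′ f
Λ-cong m≗m′ []      = refl
Λ-cong m≗m′ (c ∷ f) = cong₂ (λ x y → c * x + y) (m≗m′ 0) (Λ-cong (m≗m′ ∘ suc) f)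

Λ-additive : ∀ m f g → Λ m (f ⊕ g) ≡ Λ m f + Λ m g
Λ-additive m []      g       = sym (+-identityˡ (Λ m g))
Λ-additive m (c ∷ f) []      = sym (+-identityʳ (Λ m (c ∷ f)))
Λ-additive m (c ∷ f) (d ∷ g) = trans (cong ((c + d) * m 0 +_) (Λ-additive (m ∘ suc) f g))
                                     (interchange c d (m 0) (Λ (m ∘ suc) f) (Λ (m ∘ suc) g))
  where
  interchange : ∀ c d μ x y → (c + d) * μ + (x + y) ≡ (c * μ + x) + (d * μ + y)
  interchange = solve-∀ ℚ-ring

Λ-homogeneous : ∀ m a f → Λ m (a · f) ≡ a * Λ m f
Λ-homogeneous m a []      = sym (*-zeroʳ a)
Λ-homogeneous m a (c ∷ f) = trans (cong (a * c * m 0 +_) (Λ-homogeneous (m ∘ suc) a f))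
                                  (distrib a c (m 0) (Λ (m ∘ suc) f))
  where
  distrib : ∀ a c μ x → a * c * μ + a * x ≡ a * (c * μ + x)
  distrib = solve-∀ ℚ-ring

Λ-shiftFamily : ∀ m → IsShiftFamily (λ j → Λ (λ r → m (r ℕ.+ j)))
Λ-shiftFamily m = record
  { isLinear = λ j → record { additive = Λ-additive (λ r → m (r ℕ.+ j)) ; homogeneous = Λ-homogeneous (λ r → m (r ℕ.+ j)) }
  ; shift    = λ j f → trans (0*x+y≡y (m j) (Λ (λ r → m (suc r ℕ.+ j)) f))
                             (Λ-cong (λ r → cong m (sym (ℕₚ.+-suc r j))) f)
  }
  where
  0*x+y≡y : ∀ x y → 0ℚ * x + y ≡ y
  0*x+y≡y = solve-∀ ℚ-ring

Λ-vanish : ∀ m f → (∀ r → coeff f r ≡ 0ℚ) → Λ m f ≡ 0ℚ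
Λ-vanish m []      _     = refl
Λ-vanish m (c ∷ f) coeff≡0 = trans (cong₂ (λ x y → x * m 0 + y) (coeff≡0 0) (Λ-vanish (m ∘ suc) f (coeff≡0 ∘ suc)))
                                   (0*x+0≡0 (m 0))
  where
  0*x+0≡0 : ∀ x → 0ℚ * x + 0ℚ ≡ 0ℚ
  0*x+0≡0 = solve-∀ ℚ-ring

Λ≡sumFin : ∀ K m f → (∀ r → K ≤ r → coeff f r ≡ 0ℚ) → sumFin K (λ r → coeff f (toℕ r) * m (toℕ r)) ≡ Λ m f
Λ≡sumFin zero    m f       coeff≡0 = sym (Λ-vanish m f (λ r → coeff≡0 r z≤n))
Λ≡sumFin (suc K) m []      _       = sumFin-zero (suc K) (λ r → *-zeroˡ (m (toℕ r)))
Λ≡sumFin (suc K) m (c ∷ f) coeff≡0 = cong (c * m 0 +_) (Λ≡sumFin K (m ∘ suc) f (λ r K≤r → coeff≡0 (suc r) (s≤s K≤r)))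

moments-against-p : ∀ b K i j → i < K → sumFin K (λ r → coeff (p b i) (toℕ r) * M b (toℕ r ℕ.+ j)) ≡ mixedMoment b j i
moments-against-p b K i j i<K = trans
  (Λ≡sumFin K (λ r → M b (r ℕ.+ j)) (p b i) (λ r K≤r → coeff-p-vanish b i r (ℕₚ.<-≤-trans i<K K≤r)))
  (shiftFamily-fromMoments b (Λ-shiftFamily (M b)) (λ j → trans (1*x+0≡x (M b j)) (sym (mixedMoment-0≡M b j))) i j)

hankel-det : ∀ b k → det (suc k) (λ i j → M b (toℕ i ℕ.+ toℕ j)) ≡ (ℕ→ℚ 2 - b) ^ℚ k
hankel-det b k = begin
  det (suc k) H                                  ≡⟨ sym (det-lowerUnitriangular-*ᴹ (suc k) P H P-monic P-vanish) ⟩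
  det (suc k) (P *ᴹ H)                           ≡⟨ det-cong (suc k) P*H≡U ⟩
  det (suc k) U                                  ≡⟨ det-upperTriangular k U U-upper ⟩
  1ℚ * det k (λ i j → U (suc i) (suc j))         ≡⟨ *-identityˡ _ ⟩
  det k (λ i j → U (suc i) (suc j))              ≡⟨ det-upperTriangular-constDiag k (λ i j → U (suc i) (suc j)) (ℕ→ℚ 2 - b)
                                                      (λ i j j<i → U-upper (suc i) (suc j) (s≤s j<i)) (λ i → mixedMoment-diag b (toℕ i)) ⟩
  (ℕ→ℚ 2 - b) ^ℚ k                               ∎
  where
  open ≡-Reasoning
  H P U : Mat (suc k)
  H i j = M b (toℕ i ℕ.+ toℕ j)
  P i r = coeff (p b (toℕ i)) (toℕ r)
  U i j = mixedMoment b (toℕ j) (toℕ i)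
  P-monic : ∀ i → P i i ≡ 1ℚ
  P-monic i = coeff-p-monic b (toℕ i)
  P-vanish : ∀ i r → i Fin.< r → P i r ≡ 0ℚ
  P-vanish i r = coeff-p-vanish b (toℕ i) (toℕ r)
  U-upper : UpperTriangular U
  U-upper i j = mixedMoment-vanish b (toℕ j) (toℕ i)
  P*H≡U : ∀ i j → (P *ᴹ H) i j ≡ U i j
  P*H≡U i j = moments-against-p b (suc k) (toℕ i) (toℕ j) (Finₚ.toℕ<n i)

lemma8 : (b : ℚ) →
    ((m : ℕ) (j : ℕ) → coeff (p b (suc m)) j ≡ closedCoeff b m j)
    × ((L : Poly → ℚ) → IsLinear L → ((n : ℕ) → L (p b n) ≡ iverson0 n)
        → (n : ℕ) → L (X^ n) ≡ M b n)
    × ((k : ℕ) → det (suc k) (λ i j → M b (toℕ i Data.Nat.+ toℕ j)) ≡ (ℕ→ℚ 2 - b) ^ℚ k)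
lemma8 b = (λ m j → trans (coeff-p≡closedForm b m j) (sym (closedCoeff≡closedForm b m j)))
         , moments-from-orthogonality b
         , hankel-det b
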